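{- Let $n\ge1$ be an integer. For a coprime pair $a,b$ write the numerator of $M_{a/b}$ as $P_{a/b}(u,v,w)=\sum_{k\ge0}u^kS_k(v,w)$. Then for $a/b=1/n$, $$S_1(v,w)=\sum_{k=1}^{n}k\,v^{k-1}w^{n-k},$$ and for $a/b=2/(2n-1)$, $$S_1(v,w)=2n\,v^{2n-1}+\sum_{k=1}^{n-1}4k\,v^{n+k-1}w^{n-k}.$$
   Context: Markov polynomials $M_\rho(x,y,z)$, $\rho\in\mathbb{Q}_{\ge0}\cup\{1/0\}$, are defined recursively by $M_{0/1}=x$, $M_{1/0}=y$, $M_{1/1}=(x^2+y^2)/z$, and: whenever $p/q$, $r/s$ are fractions in lowest terms with $p,q,r,s\ge0$, $qr-ps=1$, mediant $\mu=(p+r)/(q+s)$, then $M_{(2p+r)/(2q+s)}=(M_{p/q}^2+M_\mu^2)/M_{r/s}$ and $M_{(p+2r)/(q+2s)}=(M_\mu^2+M_{r/s}^2)/M_{p/q}$. For coprime positive $a,b$ one has $M_{a/b}(x,y,z)=P_{a/b}(x^2,y^2,z^2)/(x^{a-1}y^{b-1}z^{a+b-1})$ with $P_{a/b}(u,v,w)$ a homogeneous polynomial of degree $a+b-1$ (the numerator). -}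

module Defs where

open import Data.Nat as ℕ using (ℕ; zero; suc)
open import Data.Integer as ℤ using (ℤ; +_; 0ℤ; 1ℤ)
open import Data.Product using (_×_; _,_)
open import Data.List using (List; []; _∷_; _++_; map; concatMap; upTo)
open import Data.Bool using (Bool; if_then_else_; _∧_)
open import Relation.Nullary.Decidable using (⌊_⌋)
open import Relation.Binary.PropositionalEquality using (_≡_)

-- Laurent polynomials in x, y, z with integer coefficients:
-- ℤ[x^±1, y^±1, z^±1], represented as finite lists of terms
-- (coefficient , (exp-x , exp-y , exp-z)), with equality meaning
-- equality of all coefficients (a setoid; no quotient).

Exp : Set
Exp = ℤ × ℤ × ℤ

Laurent : Set
Laurent = List (ℤ × Exp)

_=ᵉ_ : Exp → Exp → Bool
(a , b , c) =ᵉ (a' , b' , c') = ⌊ a ℤ.≟ a' ⌋ ∧ ⌊ b ℤ.≟ b' ⌋ ∧ ⌊ c ℤ.≟ c' ⌋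

coeff : Laurent → Exp → ℤ
coeff [] e = 0ℤ
coeff ((c , e') ∷ ts) e = (if e' =ᵉ e then c else 0ℤ) ℤ.+ coeff ts e

_≈_ : Laurent → Laurent → Set
p ≈ q = ∀ e → coeff p e ≡ coeff q e

infix 4 _≈_
infixl 6 _⊕_
infixl 7 _⊗_

_⊕_ : Laurent → Laurent → Laurent
p ⊕ q = p ++ q

addExp : Exp → Exp → Exp
addExp (a , b , c) (a' , b' , c') = (a ℤ.+ a' , b ℤ.+ b' , c ℤ.+ c')

_⊗_ : Laurent → Laurent → Laurent
p ⊗ q = concatMap (λ { (c , e) → map (λ { (d , f) → (c ℤ.* d , addExp e f) }) q }) p

mono : ℤ → ℤ → ℤ → Laurent
mono i j k = (1ℤ , (i , j , k)) ∷ []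

X Y Z : Laurent
X = mono (+ 1) (+ 0) (+ 0)
Y = mono (+ 0) (+ 1) (+ 0)
Z = mono (+ 0) (+ 0) (+ 1)

-- M a b stands for M_{a/b}  (1/0 is M 1 0).
-- The defining relations, with the divisions multiplied out
-- (Laurent polynomials form an integral domain and all M are nonzero,
-- so these relations determine M_{a/b} for all coprime a, b ≥ 0).

record IsMarkovFamily (M : ℕ → ℕ → Laurent) : Set where
  field
    base₀₁ : M 0 1 ≈ X
    base₁₀ : M 1 0 ≈ Y
    base₁₁ : M 1 1 ⊗ Z ≈ X ⊗ X ⊕ Y ⊗ Y
    -- p/q, r/s with q r - p s = 1, mediant (p+r)/(q+s)
    left  : ∀ p q r s → q ℕ.* r ≡ 1 ℕ.+ p ℕ.* s →
            M (2 ℕ.* p ℕ.+ r) (2 ℕ.* q ℕ.+ s) ⊗ M r s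
              ≈ M p q ⊗ M p q ⊕ M (p ℕ.+ r) (q ℕ.+ s) ⊗ M (p ℕ.+ r) (q ℕ.+ s)
    right : ∀ p q r s → q ℕ.* r ≡ 1 ℕ.+ p ℕ.* s →
            M (p ℕ.+ 2 ℕ.* r) (q ℕ.+ 2 ℕ.* s) ⊗ M p q
              ≈ M (p ℕ.+ r) (q ℕ.+ s) ⊗ M (p ℕ.+ r) (q ℕ.+ s) ⊕ M r s ⊗ M r s

-- Numerator:  P_{a/b}(x², y², z²) = x^{a-1} y^{b-1} z^{a+b-1} M_{a/b}.
numeratorXYZ : (ℕ → ℕ → Laurent) → ℕ → ℕ → Laurent
numeratorXYZ M a b =
  mono (+ a ℤ.- 1ℤ) (+ b ℤ.- 1ℤ) (+ (a ℕ.+ b) ℤ.- 1ℤ) ⊗ M a b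

Pcoeff : (ℕ → ℕ → Laurent) → ℕ → ℕ → ℕ → ℕ → ℕ → ℤ
Pcoeff M a b i j k = coeff (numeratorXYZ M a b) (+ (2 ℕ.* i) , + (2 ℕ.* j) , + (2 ℕ.* k))

S₁coeff : (ℕ → ℕ → Laurent) → ℕ → ℕ → ℕ → ℕ → ℤ
S₁coeff M a b j k = Pcoeff M a b 1 j k

Poly₂ : Set
Poly₂ = List (ℤ × ℕ × ℕ)

coeff₂ : Poly₂ → ℕ → ℕ → ℤ
coeff₂ [] j k = 0ℤ
coeff₂ ((c , a , b) ∷ ts) j k =
  (if ⌊ a ℕ.≟ j ⌋ ∧ ⌊ b ℕ.≟ k ⌋ then c else 0ℤ) ℤ.+ coeff₂ ts j k

-- the list [m, m+1, ..., n]  (empty if n < m)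
range : ℕ → ℕ → List ℕ
range m n = map (m ℕ.+_) (upTo (suc n ℕ.∸ m))

target₁ : ℕ → Poly₂
target₁ n = map (λ k → (+ k , k ℕ.∸ 1 , n ℕ.∸ k)) (range 1 n)

target₂ : ℕ → Poly₂
target₂ n = (+ (2 ℕ.* n) , 2 ℕ.* n ℕ.∸ 1 , 0)
          ∷ map (λ k → (+ (4 ℕ.* k) , n ℕ.+ k ℕ.∸ 1 , n ℕ.∸ k)) (range 1 (n ℕ.∸ 1))

module Submission where

-- Write q = y²/z², μ_s = y^{s+1} z^{-s} = M_{1/s}(0, y, z) and C_s = Σ_{t=1}^{s} t q^t.  Then
-- T_s = μ_s + x² μ_s⁻¹ C_s agrees with M_{1/s} modulo x³.  Modulo x⁴ the x⁰ part of
-- T_{s+2} T_s - x² - T_{s+1}² vanishes because μ_{s+2} μ_s = μ_{s+1}², and its x² part is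
-- q C_s + q⁻¹ C_{s+2} - 1 - 2 C_{s+1} = 0, an identity proved by induction on s.  So T satisfies the
-- recurrence M_{1/(s+2)} M_{1/s} = x² + M_{1/(s+1)}², and since M_{1/s} ≡ μ_s (mod x) is a unit
-- monomial, this recurrence determines M_{1/(s+2)} modulo x³ from its two predecessors.
-- Hence the x² part of P_{1/n}(x², y², z²) = y^{n-1} z^n M_{1/n} is x² y^{-2} z^{2n} C_n, that is
-- Σ_t t u v^{t-1} w^{n-t} with (u, v, w) = (x², y², z²).  For 2/(2m+1), where n = m + 1, the relation
-- x M_{2/(2m+1)} = M_{1/(m+1)}² + M_{1/m}² reduces the x² part of the numerator to
-- y^{2m} z^{2m+2} (2 C_{m+1} + 2 C_m) x².

open import Defs
open import Data.Nat using (ℕ; _≤_; _*_; _∸_)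
open import Data.Product using (_×_)
open import Relation.Binary.PropositionalEquality using (_≡_)

open import Level using (0ℓ)
open import Function.Base using (id; _∘_; case_of_)
open import Function.Bundles using (_⇔_; mk⇔; module Equivalence)
open import Function.Properties.Equivalence using () renaming (refl to ⇔-refl; trans to ⇔-trans)
open import Data.Bool using (Bool; true; false; if_then_else_; _∧_)
open import Data.Nat as ℕ using (zero; suc)
import Data.Nat.Properties as ℕ
open import Data.Nat.Tactic.RingSolver using () renaming (solve-∀ to ℕ-solve-∀)
open import Data.Integer as ℤ using (ℤ; +_; 0ℤ; 1ℤ)
import Data.Integer.Properties as ℤ
open import Data.Integer.Tactic.RingSolver using (solve-∀)
open import Data.Product using (_,_; proj₁; proj₂)
open import Data.Product.Function.NonDependent.Propositional using (_×-⇔_)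
open import Data.List using ([]; _∷_; _++_; map; filter; upTo)
import Data.List.Properties as List
open import Data.List.Relation.Unary.All as All using (All; []; _∷_)
open import Data.List.Relation.Unary.All.Properties using (all-filter; map⁺; applyUpTo⁺₁)
open import Relation.Nullary.Decidable
  using (Dec; yes; no; does; ⌊_⌋; map′; _×-dec_; does-⇔; isYes≗does; dec-false)
open import Relation.Unary using (Decidable)
open import Relation.Binary.Bundles using (Setoid)
open import Relation.Binary.Definitions using (DecidableEquality)
open import Relation.Binary.PropositionalEquality
  using (_≢_; refl; sym; trans; cong; cong₂; subst; module ≡-Reasoning)
import Relation.Binary.Reasoning.Setoid as SetoidReasoning
open import Algebra.Bundles using (CommutativeRing)
open import Algebra.Structures using (IsCommutativeRing)

xdeg : Exp → ℤ
xdeg = proj₁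

_≟ᵉ_ : DecidableEquality Exp
(a , b , c) ≟ᵉ (a′ , b′ , c′) =
  map′ (λ { (refl , refl , refl) → refl }) (λ { refl → refl , refl , refl })
       (a ℤ.≟ a′ ×-dec b ℤ.≟ b′ ×-dec c ℤ.≟ c′)

_+ᵉ_ : Exp → Exp → Exp
_+ᵉ_ = addExp

_-ᵉ_ : Exp → Exp → Exp
(a , b , c) -ᵉ (a′ , b′ , c′) = (a ℤ.- a′ , b ℤ.- b′ , c ℤ.- c′)

0ᵉ : Exp
0ᵉ = (0ℤ , 0ℤ , 0ℤ)

infixl 6 _+ᵉ_ _-ᵉ_
infix 4 _≟ᵉ_

private
  componentwise : ∀ {a b c a′ b′ c′ : ℤ} → a ≡ a′ → b ≡ b′ → c ≡ c′ → (a , b , c) ≡ (a′ , b′ , c′)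
  componentwise refl refl refl = refl

+ᵉ-comm : ∀ e f → e +ᵉ f ≡ f +ᵉ e
+ᵉ-comm (a , b , c) (a′ , b′ , c′) = componentwise (ℤ.+-comm a a′) (ℤ.+-comm b b′) (ℤ.+-comm c c′)

e-[f+g]≡e-f-g : ∀ e f g → e -ᵉ (f +ᵉ g) ≡ e -ᵉ f -ᵉ g
e-[f+g]≡e-f-g (a , b , c) (a′ , b′ , c′) (a″ , b″ , c″) = componentwise (lemma a a′ a″) (lemma b b′ b″) (lemma c c′ c″)
  where
  lemma : ∀ x y z → x ℤ.- (y ℤ.+ z) ≡ x ℤ.- y ℤ.- z
  lemma = solve-∀

e+f-f≡e : ∀ e f → e +ᵉ f -ᵉ f ≡ e
e+f-f≡e (a , b , c) (a′ , b′ , c′) = componentwise (lemma a a′) (lemma b b′) (lemma c c′)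
  where
  lemma : ∀ x y → x ℤ.+ y ℤ.- y ≡ x
  lemma = solve-∀

e-0≡e : ∀ e → e -ᵉ 0ᵉ ≡ e
e-0≡e (a , b , c) = componentwise (ℤ.+-identityʳ a) (ℤ.+-identityʳ b) (ℤ.+-identityʳ c)

f+[e-f]≡e : ∀ e f → f +ᵉ (e -ᵉ f) ≡ e
f+[e-f]≡e (a , b , c) (a′ , b′ , c′) = componentwise (lemma a a′) (lemma b b′) (lemma c c′)
  where
  lemma : ∀ x y → y ℤ.+ (x ℤ.- y) ≡ x
  lemma = solve-∀

=ᵉ≡does : ∀ e f → (e =ᵉ f) ≡ does (e ≟ᵉ f)
=ᵉ≡does (a , b , c) (a′ , b′ , c′) =
  cong₂ _∧_ (isYes≗does (a ℤ.≟ a′)) (cong₂ _∧_ (isYes≗does (b ℤ.≟ b′)) (isYes≗does (c ℤ.≟ c′)))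

+ᵉ=ᵉ-shift : ∀ f g e → ((f +ᵉ g) =ᵉ e) ≡ (g =ᵉ (e -ᵉ f))
+ᵉ=ᵉ-shift f g e rewrite =ᵉ≡does (f +ᵉ g) e | =ᵉ≡does g (e -ᵉ f) =
  does-⇔ (mk⇔ to from) (f +ᵉ g ≟ᵉ e) (g ≟ᵉ e -ᵉ f)
  where
  to : f +ᵉ g ≡ e → g ≡ e -ᵉ f
  to refl = sym (trans (cong (_-ᵉ f) (+ᵉ-comm f g)) (e+f-f≡e g f))
  from : g ≡ e -ᵉ f → f +ᵉ g ≡ e
  from refl = f+[e-f]≡e e f

=ᵉ-≢ : ∀ {f e} → f ≢ e → (f =ᵉ e) ≡ false
=ᵉ-≢ {f} {e} f≢e = trans (=ᵉ≡does f e) (dec-false (f ≟ᵉ e) f≢e)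

coeff-++ : ∀ p q e → coeff (p ++ q) e ≡ coeff p e ℤ.+ coeff q e
coeff-++ []            q e = sym (ℤ.+-identityˡ (coeff q e))
coeff-++ ((c , f) ∷ p) q e rewrite coeff-++ p q e =
  sym (ℤ.+-assoc (if f =ᵉ e then c else 0ℤ) (coeff p e) (coeff q e))

if-*ʳ : ∀ (b : Bool) c d → (if b then c ℤ.* d else 0ℤ) ≡ c ℤ.* (if b then d else 0ℤ)
if-*ʳ true  c d = refl
if-*ʳ false c d = sym (ℤ.*-zeroʳ c)

scaleShift : ℤ → Exp → Laurent → Laurent
scaleShift c f = map (λ (d , g) → (c ℤ.* d , f +ᵉ g))

coeff-scaleShift : ∀ c f q e → coeff (scaleShift c f q) e ≡ c ℤ.* coeff q (e -ᵉ f)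
coeff-scaleShift c f []            e = sym (ℤ.*-zeroʳ c)
coeff-scaleShift c f ((d , g) ∷ q) e = begin
  (if (f +ᵉ g) =ᵉ e then c ℤ.* d else 0ℤ) ℤ.+ coeff (scaleShift c f q) e
    ≡⟨ cong₂ ℤ._+_ (cong (λ b → if b then c ℤ.* d else 0ℤ) (+ᵉ=ᵉ-shift f g e)) (coeff-scaleShift c f q e) ⟩
  (if g =ᵉ (e -ᵉ f) then c ℤ.* d else 0ℤ) ℤ.+ c ℤ.* coeff q (e -ᵉ f)
    ≡⟨ cong (ℤ._+ c ℤ.* coeff q (e -ᵉ f)) (if-*ʳ (g =ᵉ (e -ᵉ f)) c d) ⟩
  c ℤ.* (if g =ᵉ (e -ᵉ f) then d else 0ℤ) ℤ.+ c ℤ.* coeff q (e -ᵉ f)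
    ≡⟨ ℤ.*-distribˡ-+ c _ _ ⟨
  c ℤ.* coeff ((d , g) ∷ q) (e -ᵉ f) ∎
  where open ≡-Reasoning

conv : Laurent → (Exp → ℤ) → Exp → ℤ
conv []            g e = 0ℤ
conv ((c , f) ∷ p) g e = c ℤ.* g (e -ᵉ f) ℤ.+ conv p g e

coeff-⊗ : ∀ p q e → coeff (p ⊗ q) e ≡ conv p (coeff q) e
coeff-⊗ []            q e = refl
coeff-⊗ ((c , f) ∷ p) q e = begin
  coeff (scaleShift c f q ++ p ⊗ q) e               ≡⟨ coeff-++ (scaleShift c f q) (p ⊗ q) e ⟩
  coeff (scaleShift c f q) e ℤ.+ coeff (p ⊗ q) e    ≡⟨ cong₂ ℤ._+_ (coeff-scaleShift c f q e) (coeff-⊗ p q e) ⟩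
  c ℤ.* coeff q (e -ᵉ f) ℤ.+ conv p (coeff q) e     ∎
  where open ≡-Reasoning

conv-++ : ∀ p q g e → conv (p ++ q) g e ≡ conv p g e ℤ.+ conv q g e
conv-++ []            q g e = sym (ℤ.+-identityˡ _)
conv-++ ((c , f) ∷ p) q g e rewrite conv-++ p q g e = sym (ℤ.+-assoc (c ℤ.* g (e -ᵉ f)) _ _)

conv-cong : ∀ p {g h} → (∀ x → g x ≡ h x) → ∀ e → conv p g e ≡ conv p h e
conv-cong []            g≗h e = refl
conv-cong ((c , f) ∷ p) g≗h e = cong₂ ℤ._+_ (cong (c ℤ.*_) (g≗h (e -ᵉ f))) (conv-cong p g≗h e)

conv-+ : ∀ p g h e → conv p (λ x → g x ℤ.+ h x) e ≡ conv p g e ℤ.+ conv p h e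
conv-+ []            g h e = refl
conv-+ ((c , f) ∷ p) g h e rewrite conv-+ p g h e = lemma c (g (e -ᵉ f)) (h (e -ᵉ f)) (conv p g e) (conv p h e)
  where
  lemma : ∀ c a b u v → c ℤ.* (a ℤ.+ b) ℤ.+ (u ℤ.+ v) ≡ (c ℤ.* a ℤ.+ u) ℤ.+ (c ℤ.* b ℤ.+ v)
  lemma = solve-∀

conv-0 : ∀ p e → conv p (λ _ → 0ℤ) e ≡ 0ℤ
conv-0 []            e = refl
conv-0 ((c , f) ∷ p) e rewrite conv-0 p e | ℤ.*-zeroʳ c = refl

conv-scaleShift : ∀ c f q g e → conv (scaleShift c f q) g e ≡ c ℤ.* conv q g (e -ᵉ f)
conv-scaleShift c f []            g e = sym (ℤ.*-zeroʳ c)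
conv-scaleShift c f ((d , h) ∷ q) g e
  rewrite conv-scaleShift c f q g e | e-[f+g]≡e-f-g e f h = lemma c d (g (e -ᵉ f -ᵉ h)) (conv q g (e -ᵉ f))
  where
  lemma : ∀ c d a u → c ℤ.* d ℤ.* a ℤ.+ c ℤ.* u ≡ c ℤ.* (d ℤ.* a ℤ.+ u)
  lemma = solve-∀

conv-⊗ : ∀ p q g e → conv (p ⊗ q) g e ≡ conv p (conv q g) e
conv-⊗ []            q g e = refl
conv-⊗ ((c , f) ∷ p) q g e = trans (conv-++ (scaleShift c f q) (p ⊗ q) g e)
  (cong₂ ℤ._+_ (conv-scaleShift c f q g e) (conv-⊗ p q g e))

conv-term : ∀ q c f e → conv q (λ x → if f =ᵉ x then c else 0ℤ) e ≡ c ℤ.* coeff q (e -ᵉ f)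
conv-term []            c f e = sym (ℤ.*-zeroʳ c)
conv-term ((d , g) ∷ q) c f e = begin
  d ℤ.* (if f =ᵉ (e -ᵉ g) then c else 0ℤ) ℤ.+ conv q _ e
    ≡⟨ cong₂ ℤ._+_ (swap-if (trans (sym (+ᵉ=ᵉ-shift g f e)) (trans (cong (_=ᵉ e) (+ᵉ-comm g f)) (+ᵉ=ᵉ-shift f g e))))
                   (conv-term q c f e) ⟩
  c ℤ.* (if g =ᵉ (e -ᵉ f) then d else 0ℤ) ℤ.+ c ℤ.* coeff q (e -ᵉ f)
    ≡⟨ ℤ.*-distribˡ-+ c _ _ ⟨
  c ℤ.* coeff ((d , g) ∷ q) (e -ᵉ f) ∎
  where
  open ≡-Reasoning
  swap-if : ∀ {b b′} → b ≡ b′ → d ℤ.* (if b then c else 0ℤ) ≡ c ℤ.* (if b′ then d else 0ℤ)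
  swap-if {true}  refl = ℤ.*-comm d c
  swap-if {false} refl = trans (ℤ.*-zeroʳ d) (sym (ℤ.*-zeroʳ c))

conv-comm : ∀ p q e → conv p (coeff q) e ≡ conv q (coeff p) e
conv-comm []            q e = sym (conv-0 q e)
conv-comm ((c , f) ∷ p) q e = begin
  c ℤ.* coeff q (e -ᵉ f) ℤ.+ conv p (coeff q) e
    ≡⟨ cong₂ ℤ._+_ (sym (conv-term q c f e)) (conv-comm p q e) ⟩
  conv q (λ x → if f =ᵉ x then c else 0ℤ) e ℤ.+ conv q (coeff p) e
    ≡⟨ conv-+ q (λ x → if f =ᵉ x then c else 0ℤ) (coeff p) e ⟨
  conv q (coeff ((c , f) ∷ p)) e ∎
  where open ≡-Reasoning

neg : Laurent → Laurent
neg = map (λ (c , f) → (ℤ.- c , f))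

const : ℤ → Laurent
const c = (c , 0ᵉ) ∷ []

one : Laurent
one = const 1ℤ

coeff-neg : ∀ p e → coeff (neg p) e ≡ ℤ.- coeff p e
coeff-neg []            e = refl
coeff-neg ((c , f) ∷ p) e rewrite coeff-neg p e = trans (cong (ℤ._+ ℤ.- coeff p e) (if-neg (f =ᵉ e)))
  (sym (ℤ.neg-distrib-+ (if f =ᵉ e then c else 0ℤ) (coeff p e)))
  where
  if-neg : ∀ b → (if b then ℤ.- c else 0ℤ) ≡ ℤ.- (if b then c else 0ℤ)
  if-neg true  = refl
  if-neg false = refl

coeff-one⊗ : ∀ p e → coeff (one ⊗ p) e ≡ coeff p e
coeff-one⊗ p e = begin
  coeff (one ⊗ p) e                    ≡⟨ coeff-⊗ one p e ⟩
  1ℤ ℤ.* coeff p (e -ᵉ 0ᵉ) ℤ.+ 0ℤ      ≡⟨ ℤ.+-identityʳ _ ⟩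
  1ℤ ℤ.* coeff p (e -ᵉ 0ᵉ)             ≡⟨ ℤ.*-identityˡ _ ⟩
  coeff p (e -ᵉ 0ᵉ)                    ≡⟨ cong (coeff p) (e-0≡e e) ⟩
  coeff p e                            ∎
  where open ≡-Reasoning

-- A record rather than p ≈ q itself, so that p and q can be inferred from a proof.
record _≋_ (p q : Laurent) : Set where
  constructor ⟨_⟩
  field
    coeff-≡ : p ≈ q
open _≋_ public

infix 4 _≋_

Laurent-isCommutativeRing : IsCommutativeRing _≋_ _⊕_ _⊗_ neg [] one
Laurent-isCommutativeRing = record
  { isRing = record
    { +-isAbelianGroup = record
      { isGroup = record
        { isMonoid = record
          { isSemigroup = record
            { isMagma = record
              { isEquivalence = record { refl = ⟨ (λ e → refl) ⟩ ; sym = ≋-sym ; trans = ≋-trans }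
              ; ∙-cong = ⊕-cong }
            ; assoc = λ p q r → ⟨ (λ e → cong (λ s → coeff s e) (List.++-assoc p q r)) ⟩ }
          ; identity = (λ p → ⟨ (λ e → refl) ⟩) , (λ p → ⟨ (λ e → cong (λ s → coeff s e) (List.++-identityʳ p)) ⟩) }
        ; inverse = (λ p → ≋-trans (⊕-comm (neg p) p) (inverseʳ p)) , inverseʳ
        ; ⁻¹-cong = λ {p} {q} p≋q → ⟨ (λ e → trans (coeff-neg p e) (trans (cong ℤ.-_ (coeff-≡ p≋q e)) (sym (coeff-neg q e)))) ⟩ }
      ; comm = ⊕-comm }
    ; *-cong = λ {p} {p′} {q} {q′} p≋p′ q≋q′ →
        ≋-trans (⊗-congʳ p q≋q′) (≋-trans (⊗-comm p q′) (≋-trans (⊗-congʳ q′ p≋p′) (⊗-comm q′ p′)))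
    ; *-assoc = ⊗-assoc
    ; *-identity = identityˡ , (λ p → ≋-trans (⊗-comm p one) (identityˡ p))
    ; distrib = (λ p q r → ≋-trans (⊗-comm p (q ⊕ r)) (≋-trans (⊗-distribʳ p q r) (⊕-cong (⊗-comm q p) (⊗-comm r p))))
              , ⊗-distribʳ }
  ; *-comm = ⊗-comm }
  where
  ⊗-comm : ∀ p q → p ⊗ q ≋ q ⊗ p
  ⊗-comm p q = ⟨ (λ e → trans (coeff-⊗ p q e) (trans (conv-comm p q e) (sym (coeff-⊗ q p e)))) ⟩

  ⊗-congʳ : ∀ p {q q′} → q ≋ q′ → p ⊗ q ≋ p ⊗ q′
  ⊗-congʳ p ⟨ q≈q′ ⟩ = ⟨ (λ e → trans (coeff-⊗ p _ e) (trans (conv-cong p q≈q′ e) (sym (coeff-⊗ p _ e)))) ⟩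

  ⊗-distribʳ : ∀ p q r → (q ⊕ r) ⊗ p ≋ q ⊗ p ⊕ r ⊗ p
  ⊗-distribʳ p q r = ⟨ (λ e → begin
    coeff ((q ⊕ r) ⊗ p) e                     ≡⟨ coeff-⊗ (q ++ r) p e ⟩
    conv (q ++ r) (coeff p) e                 ≡⟨ conv-++ q r (coeff p) e ⟩
    conv q (coeff p) e ℤ.+ conv r (coeff p) e ≡⟨ cong₂ ℤ._+_ (coeff-⊗ q p e) (coeff-⊗ r p e) ⟨
    coeff (q ⊗ p) e ℤ.+ coeff (r ⊗ p) e       ≡⟨ coeff-++ (q ⊗ p) (r ⊗ p) e ⟨
    coeff (q ⊗ p ⊕ r ⊗ p) e                   ∎) ⟩
    where open ≡-Reasoning

  ⊗-assoc : ∀ p q r → (p ⊗ q) ⊗ r ≋ p ⊗ (q ⊗ r)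
  ⊗-assoc p q r = ⟨ (λ e → begin
    coeff ((p ⊗ q) ⊗ r) e                  ≡⟨ coeff-⊗ (p ⊗ q) r e ⟩
    conv (p ⊗ q) (coeff r) e               ≡⟨ conv-⊗ p q (coeff r) e ⟩
    conv p (conv q (coeff r)) e            ≡⟨ conv-cong p (λ x → coeff-⊗ q r x) e ⟨
    conv p (coeff (q ⊗ r)) e               ≡⟨ coeff-⊗ p (q ⊗ r) e ⟨
    coeff (p ⊗ (q ⊗ r)) e                  ∎) ⟩
    where open ≡-Reasoning

  ⊕-cong : ∀ {p p′ q q′} → p ≋ p′ → q ≋ q′ → p ⊕ q ≋ p′ ⊕ q′
  ⊕-cong {p} {p′} {q} {q′} ⟨ p≈p′ ⟩ ⟨ q≈q′ ⟩ =
    ⟨ (λ e → trans (coeff-++ p q e) (trans (cong₂ ℤ._+_ (p≈p′ e) (q≈q′ e)) (sym (coeff-++ p′ q′ e)))) ⟩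

  ⊕-comm : ∀ p q → p ⊕ q ≋ q ⊕ p
  ⊕-comm p q = ⟨ (λ e → trans (coeff-++ p q e) (trans (ℤ.+-comm (coeff p e) (coeff q e)) (sym (coeff-++ q p e)))) ⟩

  ≋-sym : ∀ {p q} → p ≋ q → q ≋ p
  ≋-sym ⟨ p≈q ⟩ = ⟨ (λ e → sym (p≈q e)) ⟩

  ≋-trans : ∀ {p q r} → p ≋ q → q ≋ r → p ≋ r
  ≋-trans ⟨ p≈q ⟩ ⟨ q≈r ⟩ = ⟨ (λ e → trans (p≈q e) (q≈r e)) ⟩

  inverseʳ : ∀ p → p ⊕ neg p ≋ []
  inverseʳ p = ⟨ (λ e → trans (coeff-++ p (neg p) e) (trans (cong (λ z → coeff p e ℤ.+ z) (coeff-neg p e)) (ℤ.+-inverseʳ (coeff p e)))) ⟩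

  identityˡ : ∀ p → one ⊗ p ≋ p
  identityˡ p = ⟨ coeff-one⊗ p ⟩

Laurent-ring : CommutativeRing 0ℓ 0ℓ
Laurent-ring = record { isCommutativeRing = Laurent-isCommutativeRing }

open CommutativeRing Laurent-ring public
  using (setoid; commutativeSemiring)
  renaming ( refl to ≋-refl; reflexive to ≋-reflexive; sym to ≋-sym; trans to ≋-trans
           ; +-cong to ⊕-cong; *-cong to ⊗-cong; +-comm to ⊕-comm; *-comm to ⊗-comm; *-assoc to ⊗-assoc
           ; +-identityʳ to ⊕-identityʳ; *-identityˡ to ⊗-identityˡ; distribʳ to ⊗-distribʳ; zeroʳ to ⊗-zeroʳ)
module ≋-Reasoning = SetoidReasoning setoid
open import Algebra.Properties.Ring (CommutativeRing.ring Laurent-ring) using (-‿distribˡ-*)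
open import Algebra.Solver.Ring.NaturalCoefficients.Default commutativeSemiring
  using (solve; _:+_; _:*_; _:=_; con)

coeff-mono-⊗ : ∀ a b c p e → coeff (mono a b c ⊗ p) e ≡ coeff p (e -ᵉ (a , b , c))
coeff-mono-⊗ a b c p e = trans (coeff-⊗ (mono a b c) p e) (trans (ℤ.+-identityʳ _) (ℤ.*-identityˡ _))

mono-⊗ : ∀ a b c a′ b′ c′ → mono a b c ⊗ mono a′ b′ c′ ≋ mono (a ℤ.+ a′) (b ℤ.+ b′) (c ℤ.+ c′)
mono-⊗ a b c a′ b′ c′ = ⟨ (λ e → trans (coeff-mono-⊗ a b c (mono a′ b′ c′) e)
  (cong (λ β → (if β then 1ℤ else 0ℤ) ℤ.+ 0ℤ) (sym (+ᵉ=ᵉ-shift (a , b , c) (a′ , b′ , c′) e)))) ⟩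

yz : ℤ → ℤ → Laurent
yz = mono 0ℤ

yz-⊗ : ∀ b c b′ c′ → yz b c ⊗ yz b′ c′ ≋ yz (b ℤ.+ b′) (c ℤ.+ c′)
yz-⊗ b c b′ c′ = mono-⊗ 0ℤ b c 0ℤ b′ c′

yz-⊗-≡ : ∀ b c b′ c′ {b″ c″} → b ℤ.+ b′ ≡ b″ → c ℤ.+ c′ ≡ c″ → yz b c ⊗ yz b′ c′ ≋ yz b″ c″
yz-⊗-≡ b c b′ c′ refl refl = yz-⊗ b c b′ c′

const-+ : ∀ a b → const (a ℤ.+ b) ≋ const a ⊕ const b
const-+ a b = ⟨ (λ e → lemma (0ᵉ =ᵉ e)) ⟩
  where
  lemma : ∀ β → (if β then a ℤ.+ b else 0ℤ) ℤ.+ 0ℤ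
              ≡ (if β then a else 0ℤ) ℤ.+ ((if β then b else 0ℤ) ℤ.+ 0ℤ)
  lemma true  = trans (ℤ.+-identityʳ _) (cong (λ x → a ℤ.+ x) (sym (ℤ.+-identityʳ b)))
  lemma false = refl

term≋const⊗term : ∀ c f → (c , f) ∷ [] ≋ const c ⊗ ((1ℤ , f) ∷ [])
term≋const⊗term c f = ⟨ (λ e → begin
  (if f =ᵉ e then c else 0ℤ) ℤ.+ 0ℤ                      ≡⟨ cong (ℤ._+ 0ℤ) (lemma (f =ᵉ e)) ⟩
  c ℤ.* ((if f =ᵉ e then 1ℤ else 0ℤ) ℤ.+ 0ℤ) ℤ.+ 0ℤ       ≡⟨ cong (λ x → c ℤ.* coeff ((1ℤ , f) ∷ []) x ℤ.+ 0ℤ) (e-0≡e e) ⟨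
  c ℤ.* coeff ((1ℤ , f) ∷ []) (e -ᵉ 0ᵉ) ℤ.+ 0ℤ           ≡⟨ coeff-⊗ (const c) ((1ℤ , f) ∷ []) e ⟨
  coeff (const c ⊗ ((1ℤ , f) ∷ [])) e                   ∎) ⟩
  where
  open ≡-Reasoning
  lemma : ∀ b → (if b then c else 0ℤ) ≡ c ℤ.* ((if b then 1ℤ else 0ℤ) ℤ.+ 0ℤ)
  lemma true  = sym (ℤ.*-identityʳ c)
  lemma false = sym (ℤ.*-zeroʳ c)

⊗-assoc-≋ : ∀ m m′ {k} p → m ⊗ m′ ≋ k → m ⊗ (m′ ⊗ p) ≋ k ⊗ p
⊗-assoc-≋ m m′ p mm′≋k = ≋-trans (≋-sym (⊗-assoc m m′ p)) (⊗-cong mm′≋k ≋-refl)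

record _≈[x<_]_ (p : Laurent) (h : ℤ) (q : Laurent) : Set where
  constructor mk≈[x<]
  field
    agree : ∀ e → xdeg e ℤ.< h → coeff p e ≡ coeff q e
open _≈[x<_]_ public

infix 4 _≈[x<_]_

XOrd≥ : ℤ → Laurent → Set
XOrd≥ k p = p ≈[x< k ] []

≈[x<]-refl : ∀ {h p} → p ≈[x< h ] p
≈[x<]-refl = mk≈[x<] (λ e _ → refl)

≈[x<]-sym : ∀ {h p q} → p ≈[x< h ] q → q ≈[x< h ] p
≈[x<]-sym p≈q = mk≈[x<] (λ e lt → sym (agree p≈q e lt))

≈[x<]-trans : ∀ {h p q r} → p ≈[x< h ] q → q ≈[x< h ] r → p ≈[x< h ] r
≈[x<]-trans p≈q q≈r = mk≈[x<] (λ e lt → trans (agree p≈q e lt) (agree q≈r e lt))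

≈[x<]-setoid : ℤ → Setoid 0ℓ 0ℓ
≈[x<]-setoid h = record
  { Carrier       = Laurent
  ; _≈_           = _≈[x< h ]_
  ; isEquivalence = record { refl = ≈[x<]-refl ; sym = ≈[x<]-sym ; trans = ≈[x<]-trans } }

module ≈[x<]-Reasoning (h : ℤ) = SetoidReasoning (≈[x<]-setoid h)

≋⇒≈[x<] : ∀ {h p q} → p ≋ q → p ≈[x< h ] q
≋⇒≈[x<] p≋q = mk≈[x<] (λ e _ → coeff-≡ p≋q e)

≈[x<]-weaken : ∀ {h h′ p q} → h′ ℤ.≤ h → p ≈[x< h ] q → p ≈[x< h′ ] q
≈[x<]-weaken h′≤h p≈q = mk≈[x<] (λ e lt → agree p≈q e (ℤ.<-≤-trans lt h′≤h))

⊕-cong-≈[x<] : ∀ {h p p′ q q′} → p ≈[x< h ] p′ → q ≈[x< h ] q′ → p ⊕ q ≈[x< h ] p′ ⊕ q′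
⊕-cong-≈[x<] {p = p} {p′} {q} {q′} p≈p′ q≈q′ = mk≈[x<] (λ e lt →
  trans (coeff-++ p q e) (trans (cong₂ ℤ._+_ (agree p≈p′ e lt) (agree q≈q′ e lt)) (sym (coeff-++ p′ q′ e))))

XDeg≥ : ℤ → ℤ × Exp → Set
XDeg≥ k (c , f) = k ℤ.≤ xdeg f

XDeg≥? : ∀ k → Decidable (XDeg≥ k)
XDeg≥? k (c , f) = k ℤ.≤? xdeg f

XOrd≥-terms : ∀ k p → All (XDeg≥ k) p → XOrd≥ k p
XOrd≥-terms k []            []          = mk≈[x<] (λ e _ → refl)
XOrd≥-terms k ((c , f) ∷ p) (k≤f ∷ p≥k) = mk≈[x<] (λ e e<k →
  trans (cong (λ b → (if b then c else 0ℤ) ℤ.+ coeff p e) (=ᵉ-≢ {f} {e} (λ { refl → ℤ.<⇒≱ e<k k≤f })))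
        (trans (ℤ.+-identityˡ (coeff p e)) (agree (XOrd≥-terms k p p≥k) e e<k)))

XOrd≥-mono : ∀ a b c → XOrd≥ a (mono a b c)
XOrd≥-mono a b c = XOrd≥-terms a (mono a b c) (ℤ.≤-refl ∷ [])

x-part≥ : ℤ → Laurent → Laurent
x-part≥ k = filter (XDeg≥? k)

coeff-x-part≥ : ∀ k p e → k ℤ.≤ xdeg e → coeff (x-part≥ k p) e ≡ coeff p e
coeff-x-part≥ k []            e k≤e = refl
coeff-x-part≥ k ((c , f) ∷ p) e k≤e with k ℤ.≤? xdeg f
... | yes _  = cong (λ z → (if f =ᵉ e then c else 0ℤ) ℤ.+ z) (coeff-x-part≥ k p e k≤e)
... | no k≰f rewrite =ᵉ-≢ {f} {e} (λ { refl → k≰f k≤e }) = trans (coeff-x-part≥ k p e k≤e) (sym (ℤ.+-identityˡ _))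

XOrd≥-x-part≥ : ∀ k p → XOrd≥ k (x-part≥ k p)
XOrd≥-x-part≥ k p = XOrd≥-terms k (x-part≥ k p) (all-filter (XDeg≥? k) p)

x-part≥-≋ : ∀ {k p} → XOrd≥ k p → p ≋ x-part≥ k p
x-part≥-≋ {k} {p} p≥k = ⟨ (λ e → case-≤ e (k ℤ.≤? xdeg e)) ⟩
  where
  case-≤ : ∀ e → Dec (k ℤ.≤ xdeg e) → coeff p e ≡ coeff (x-part≥ k p) e
  case-≤ e (yes k≤e) = sym (coeff-x-part≥ k p e k≤e)
  case-≤ e (no k≰e)  = trans (agree p≥k e (ℤ.≰⇒> k≰e)) (sym (agree (XOrd≥-x-part≥ k p) e (ℤ.≰⇒> k≰e)))

x<k+h⇒x-y<h : ∀ {x y k h} → x ℤ.< k ℤ.+ h → k ℤ.≤ y → x ℤ.- y ℤ.< h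
x<k+h⇒x-y<h {x} {y} {k} {h} x<k+h k≤y = begin-strict
  x ℤ.- y         ≤⟨ ℤ.+-monoʳ-≤ x (ℤ.neg-mono-≤ k≤y) ⟩
  x ℤ.- k         <⟨ ℤ.+-monoˡ-< (ℤ.- k) x<k+h ⟩
  k ℤ.+ h ℤ.- k   ≡⟨ lemma k h ⟩
  h               ∎
  where
  open ℤ.≤-Reasoning
  lemma : ∀ k h → k ℤ.+ h ℤ.- k ≡ h
  lemma = solve-∀

conv-agree : ∀ {k h g g′} a → All (XDeg≥ k) a → (∀ x → xdeg x ℤ.< h → g x ≡ g′ x) →
             ∀ e → xdeg e ℤ.< k ℤ.+ h → conv a g e ≡ conv a g′ e
conv-agree []            []           g≈g′ e lt = refl
conv-agree ((c , f) ∷ a) (k≤f ∷ a≥k) g≈g′ e lt =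
  cong₂ ℤ._+_ (cong (c ℤ.*_) (g≈g′ (e -ᵉ f) (x<k+h⇒x-y<h lt k≤f))) (conv-agree a a≥k g≈g′ e lt)

-- The terms of a of x-degree below k cancel in total but not one by one, so a is first
-- replaced by its part of x-degree ≥ k.
⊗-congˡ-≈[x<] : ∀ {k h a p q} → XOrd≥ k a → p ≈[x< h ] q → a ⊗ p ≈[x< k ℤ.+ h ] a ⊗ q
⊗-congˡ-≈[x<] {k} {h} {a} {p} {q} a≥k p≈q = mk≈[x<] (λ e lt → begin
  coeff (a ⊗ p) e              ≡⟨ coeff-≡ (⊗-cong (x-part≥-≋ a≥k) ≋-refl) e ⟩
  coeff (a′ ⊗ p) e             ≡⟨ coeff-⊗ a′ p e ⟩
  conv a′ (coeff p) e          ≡⟨ conv-agree a′ (all-filter (XDeg≥? k) a) (agree p≈q) e lt ⟩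
  conv a′ (coeff q) e          ≡⟨ coeff-⊗ a′ q e ⟨
  coeff (a′ ⊗ q) e             ≡⟨ coeff-≡ (⊗-cong (x-part≥-≋ a≥k) ≋-refl) e ⟨
  coeff (a ⊗ q) e              ∎)
  where
  open ≡-Reasoning
  a′ = x-part≥ k a

XOrd≥-⊗ : ∀ {k h a b} → XOrd≥ k a → XOrd≥ h b → XOrd≥ (k ℤ.+ h) (a ⊗ b)
XOrd≥-⊗ {a = a} a≥k b≥h = mk≈[x<] (λ e lt →
  trans (agree (⊗-congˡ-≈[x<] a≥k b≥h) e lt) (coeff-≡ (⊗-zeroʳ a) e))

⊕-XOrd≥ : ∀ {h p r} → XOrd≥ h r → p ⊕ r ≈[x< h ] p
⊕-XOrd≥ {p = p} {r} r≥h =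
  mk≈[x<] (λ e lt → trans (coeff-++ p r e) (trans (cong (λ x → coeff p e ℤ.+ x) (agree r≥h e lt)) (ℤ.+-identityʳ (coeff p e))))

≈[x<]-XOrd≥ : ∀ {h k p q} → p ≈[x< h ] q → k ℤ.≤ h → XOrd≥ k q → XOrd≥ k p
≈[x<]-XOrd≥ p≈q k≤h q≥k = mk≈[x<] (λ e lt → trans (agree p≈q e (ℤ.<-≤-trans lt k≤h)) (agree q≥k e lt))

⊗-congˡ-≈[x<]₀ : ∀ {h a p q} → XOrd≥ 0ℤ a → p ≈[x< h ] q → a ⊗ p ≈[x< h ] a ⊗ q
⊗-congˡ-≈[x<]₀ {h} a≥0 p≈q = subst (λ h′ → _ ≈[x< h′ ] _) (ℤ.+-identityˡ h) (⊗-congˡ-≈[x<] a≥0 p≈q)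

⊗-cong-≈[x<]₀ : ∀ {h p p′ q q′} → XOrd≥ 0ℤ p → XOrd≥ 0ℤ q′ → p ≈[x< h ] p′ → q ≈[x< h ] q′ → p ⊗ q ≈[x< h ] p′ ⊗ q′
⊗-cong-≈[x<]₀ {h} {p} {p′} {q} {q′} p≥0 q′≥0 p≈p′ q≈q′ = begin
  p ⊗ q      ≈⟨ ⊗-congˡ-≈[x<]₀ p≥0 q≈q′ ⟩
  p ⊗ q′     ≈⟨ ≋⇒≈[x<] (⊗-comm p q′) ⟩
  q′ ⊗ p     ≈⟨ ⊗-congˡ-≈[x<]₀ q′≥0 p≈p′ ⟩
  q′ ⊗ p′    ≈⟨ ≋⇒≈[x<] (⊗-comm q′ p′) ⟩
  p′ ⊗ q′    ∎
  where open ≈[x<]-Reasoning h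

coeff-⊕neg : ∀ p q e → coeff (p ⊕ neg q) e ≡ coeff p e ℤ.- coeff q e
coeff-⊕neg p q e = trans (coeff-++ p (neg q) e) (cong (λ z → coeff p e ℤ.+ z) (coeff-neg q e))

XOrd≥-⊕neg⇒≈[x<] : ∀ {h p q} → XOrd≥ h (p ⊕ neg q) → p ≈[x< h ] q
XOrd≥-⊕neg⇒≈[x<] {p = p} {q} p-q≥h =
  mk≈[x<] (λ e lt → ℤ.i-j≡0⇒i≡j _ _ (trans (sym (coeff-⊕neg p q e)) (agree p-q≥h e lt)))

≈[x<]⇒XOrd≥-⊕neg : ∀ {h p q} → p ≈[x< h ] q → XOrd≥ h (p ⊕ neg q)
≈[x<]⇒XOrd≥-⊕neg {p = p} {q} p≈q =
  mk≈[x<] (λ e lt → trans (coeff-⊕neg p q e) (ℤ.i≡j⇒i-j≡0 (agree p≈q e lt)))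

i≤+∣i∣ : ∀ i → i ℤ.≤ + ℤ.∣ i ∣
i≤+∣i∣ (+ n)      = ℤ.≤-refl
i≤+∣i∣ ℤ.-[1+ n ] = ℤ.-≤+

minXdeg : Laurent → ℤ
minXdeg []            = 0ℤ
minXdeg ((c , f) ∷ p) = xdeg f ℤ.⊓ minXdeg p

minXdeg-≤ : ∀ p → All (XDeg≥ (minXdeg p)) p
minXdeg-≤ []            = []
minXdeg-≤ ((c , f) ∷ p) = ℤ.i⊓j≤i (xdeg f) (minXdeg p) ∷ All.map (ℤ.≤-trans (ℤ.i⊓j≤j (xdeg f) (minXdeg p))) (minXdeg-≤ p)

-- Cancelling a factor A ≡ y^b z^c (mod x): the part of D ⊗ A of x-degree k is y^b z^c times that
-- of D, so a lower bound k < h on the x-order of D can be raised by one until it reaches h.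
module _ {A : Laurent} {b c : ℤ} (A≈yz : A ≈[x< 1ℤ ] mono 0ℤ b c) where

  private
    m : Exp
    m = (0ℤ , b , c)

    A₊ : Laurent
    A₊ = A ⊕ neg (mono 0ℤ b c)

    A₊≥1 : XOrd≥ 1ℤ A₊
    A₊≥1 = ≈[x<]⇒XOrd≥-⊕neg A≈yz

    coeff-⊗A : ∀ D e → coeff (D ⊗ A) (e +ᵉ m) ≡ coeff D e ℤ.+ coeff (A₊ ⊗ D) (e +ᵉ m)
    coeff-⊗A D e = begin
      coeff (D ⊗ A) (e +ᵉ m)                                      ≡⟨ coeff-≡ (⊗-cong (≋-refl {D}) A≋) (e +ᵉ m) ⟩
      coeff (D ⊗ (mono 0ℤ b c ⊕ A₊)) (e +ᵉ m)                     ≡⟨ coeff-≡ (split D (mono 0ℤ b c) A₊) (e +ᵉ m) ⟩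
      coeff (mono 0ℤ b c ⊗ D ⊕ A₊ ⊗ D) (e +ᵉ m)                   ≡⟨ coeff-++ (mono 0ℤ b c ⊗ D) (A₊ ⊗ D) (e +ᵉ m) ⟩
      coeff (mono 0ℤ b c ⊗ D) (e +ᵉ m) ℤ.+ coeff (A₊ ⊗ D) (e +ᵉ m) ≡⟨ cong (ℤ._+ coeff (A₊ ⊗ D) (e +ᵉ m))
                                                                        (trans (coeff-mono-⊗ 0ℤ b c D (e +ᵉ m)) (cong (coeff D) (e+f-f≡e e m))) ⟩
      coeff D e ℤ.+ coeff (A₊ ⊗ D) (e +ᵉ m)                       ∎
      where
      open ≡-Reasoning
      A≋ : A ≋ mono 0ℤ b c ⊕ A₊
      A≋ = ⟨ (λ e → trans (lemma (coeff A e) (coeff (mono 0ℤ b c) e))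
                          (sym (trans (coeff-++ (mono 0ℤ b c) A₊ e) (cong (λ z → coeff (mono 0ℤ b c) e ℤ.+ z) (coeff-⊕neg A (mono 0ℤ b c) e))))) ⟩
        where
        lemma : ∀ a u → a ≡ u ℤ.+ (a ℤ.- u)
        lemma = solve-∀
      split : ∀ D M P → D ⊗ (M ⊕ P) ≋ M ⊗ D ⊕ P ⊗ D
      split = solve 3 (λ D M P → D :* (M :+ P) := M :* D :+ P :* D) ≋-refl

    raise : ∀ {h k D} → XOrd≥ h (D ⊗ A) → k ℤ.< h → XOrd≥ k D → XOrd≥ (1ℤ ℤ.+ k) D
    raise {h} {k} {D} DA≥h k<h D≥k = mk≈[x<] (λ e lt → begin
      coeff D e                                   ≡⟨ ℤ.+-identityʳ (coeff D e) ⟨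
      coeff D e ℤ.+ 0ℤ                            ≡⟨ cong (λ z → coeff D e ℤ.+ z) (agree (XOrd≥-⊗ A₊≥1 D≥k) (e +ᵉ m) (subst (ℤ._< 1ℤ ℤ.+ k) (sym (xdeg-+m e)) lt)) ⟨
      coeff D e ℤ.+ coeff (A₊ ⊗ D) (e +ᵉ m)       ≡⟨ coeff-⊗A D e ⟨
      coeff (D ⊗ A) (e +ᵉ m)                      ≡⟨ agree DA≥h (e +ᵉ m) (subst (ℤ._< h) (sym (xdeg-+m e)) (ℤ.<-≤-trans lt (ℤ.i<j⇒suc[i]≤j k<h))) ⟩
      0ℤ                                          ∎)
      where
      open ≡-Reasoning
      xdeg-+m : ∀ e → xdeg (e +ᵉ m) ≡ xdeg e
      xdeg-+m e = ℤ.+-identityʳ (xdeg e)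

    raise-by : ∀ N {h k D} → h ℤ.≤ k ℤ.+ + N → XOrd≥ h (D ⊗ A) → XOrd≥ k D → XOrd≥ h D
    raise-by zero    {k = k} h≤k   DA≥h D≥k = ≈[x<]-weaken (subst (_ ℤ.≤_) (ℤ.+-identityʳ k) h≤k) D≥k
    raise-by (suc N) {h} {k} h≤k+N DA≥h D≥k with k ℤ.<? h
    ... | yes k<h = raise-by N (subst (h ℤ.≤_) (lemma k (+ N)) h≤k+N) DA≥h (raise DA≥h k<h D≥k)
      where
      lemma : ∀ k n → k ℤ.+ (1ℤ ℤ.+ n) ≡ 1ℤ ℤ.+ k ℤ.+ n
      lemma = solve-∀
    ... | no k≮h  = ≈[x<]-weaken (ℤ.≮⇒≥ k≮h) D≥k

  XOrd≥-cancelʳ : ∀ {h D} → XOrd≥ h (D ⊗ A) → XOrd≥ h D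
  XOrd≥-cancelʳ {h} {D} DA≥h = raise-by ℤ.∣ h ℤ.- k ∣ h≤k+∣h-k∣ DA≥h (XOrd≥-terms (minXdeg D) D (minXdeg-≤ D))
    where
    k = minXdeg D
    h≤k+∣h-k∣ : h ℤ.≤ k ℤ.+ + ℤ.∣ h ℤ.- k ∣
    h≤k+∣h-k∣ = subst (ℤ._≤ k ℤ.+ + ℤ.∣ h ℤ.- k ∣) (lemma h k) (ℤ.+-monoʳ-≤ k (i≤+∣i∣ (h ℤ.- k)))
      where
      lemma : ∀ h k → k ℤ.+ (h ℤ.- k) ≡ h
      lemma = solve-∀

  ≈[x<]-cancelʳ : ∀ {h D D′} → D ⊗ A ≈[x< h ] D′ ⊗ A → D ≈[x< h ] D′
  ≈[x<]-cancelʳ {D = D} {D′} DA≈D′A = XOrd≥-⊕neg⇒≈[x<] (XOrd≥-cancelʳ (mk≈[x<] (λ e lt →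
    trans (coeff-≡ (≋-trans (⊗-distribʳ A D (neg D′)) (⊕-cong ≋-refl (≋-sym (-‿distribˡ-* D′ A)))) e)
          (agree (≈[x<]⇒XOrd≥-⊕neg DA≈D′A) e lt))))

X² : Laurent
X² = X ⊗ X

XOrd≥-X² : XOrd≥ (+ 2) X²
XOrd≥-X² = XOrd≥-⊗ (XOrd≥-mono 1ℤ 0ℤ 0ℤ) (XOrd≥-mono 1ℤ 0ℤ 0ℤ)

expand-mod-x⁴ : ∀ a {b} c {d} → XOrd≥ 0ℤ b → XOrd≥ 0ℤ d →
                (a ⊕ X² ⊗ b) ⊗ (c ⊕ X² ⊗ d) ≈[x< + 4 ] a ⊗ c ⊕ X² ⊗ (a ⊗ d ⊕ b ⊗ c)
expand-mod-x⁴ a {b} c {d} b≥0 d≥0 =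
  ≈[x<]-trans (≋⇒≈[x<] (lemma a b c d X²)) (⊕-XOrd≥ (XOrd≥-⊗ (XOrd≥-⊗ XOrd≥-X² XOrd≥-X²) (XOrd≥-⊗ b≥0 d≥0)))
  where
  lemma : ∀ a b c d x → (a ⊕ x ⊗ b) ⊗ (c ⊕ x ⊗ d) ≋ (a ⊗ c ⊕ x ⊗ (a ⊗ d ⊕ b ⊗ c)) ⊕ (x ⊗ x) ⊗ (b ⊗ d)
  lemma = solve 5 (λ a b c d x → (a :+ x :* b) :* (c :+ x :* d) := (a :* c :+ x :* (a :* d :+ b :* c)) :+ (x :* x) :* (b :* d)) ≋-refl

μ μ⁻¹ : ℕ → Laurent
μ   s = yz (+ suc s) (ℤ.- + s)
μ⁻¹ s = yz (ℤ.- + suc s) (+ s)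

q q⁻¹ : Laurent
q   = yz (+ 2) (ℤ.- + 2)
q⁻¹ = yz (ℤ.- + 2) (+ 2)

qexp : ℕ → Exp
qexp t = (0ℤ , + t ℤ.+ + t , ℤ.- (+ t ℤ.+ + t))

Q : ℕ → Laurent
Q t = (1ℤ , qexp t) ∷ []

C : ℕ → Laurent
C s = map (λ t → (+ t , qexp t)) (range 1 s)

w : ℕ → Laurent
w s = μ⁻¹ s ⊗ C s

T : ℕ → Laurent
T s = μ s ⊕ X² ⊗ w s

τ : ℕ → Laurent
τ t = const (+ t) ⊗ Q t

μ[2+s]⊗μ[s] : ∀ s → μ (suc (suc s)) ⊗ μ s ≋ μ (suc s) ⊗ μ (suc s)
μ[2+s]⊗μ[s] s = ≋-trans (yz-⊗-≡ (+ suc (suc (suc s))) (ℤ.- + suc (suc s)) (+ suc s) (ℤ.- + s) (lemma₁ (+ s)) (lemma₂ (+ s)))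
                (≋-sym (yz-⊗ (+ suc (suc s)) (ℤ.- + suc s) (+ suc (suc s)) (ℤ.- + suc s)))
  where
  lemma₁ : ∀ x → (1ℤ ℤ.+ (1ℤ ℤ.+ (1ℤ ℤ.+ x))) ℤ.+ (1ℤ ℤ.+ x) ≡ (1ℤ ℤ.+ (1ℤ ℤ.+ x)) ℤ.+ (1ℤ ℤ.+ (1ℤ ℤ.+ x))
  lemma₁ = solve-∀
  lemma₂ : ∀ x → ℤ.- (1ℤ ℤ.+ (1ℤ ℤ.+ x)) ℤ.+ ℤ.- x ≡ ℤ.- (1ℤ ℤ.+ x) ℤ.+ ℤ.- (1ℤ ℤ.+ x)
  lemma₂ = solve-∀

μ⊗μ⁻¹ : ∀ s → μ s ⊗ μ⁻¹ s ≋ one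
μ⊗μ⁻¹ s = yz-⊗-≡ (+ suc s) (ℤ.- + s) (ℤ.- + suc s) (+ s) (ℤ.+-inverseʳ (+ suc s)) (ℤ.+-inverseˡ (+ s))

μ[2+s]⊗μ⁻¹[s] : ∀ s → μ (suc (suc s)) ⊗ μ⁻¹ s ≋ q
μ[2+s]⊗μ⁻¹[s] s = yz-⊗-≡ (+ suc (suc (suc s))) (ℤ.- + suc (suc s)) (ℤ.- + suc s) (+ s) (lemma₁ (+ s)) (lemma₂ (+ s))
  where
  lemma₁ : ∀ x → (1ℤ ℤ.+ (1ℤ ℤ.+ (1ℤ ℤ.+ x))) ℤ.+ ℤ.- (1ℤ ℤ.+ x) ≡ + 2
  lemma₁ = solve-∀
  lemma₂ : ∀ x → ℤ.- (1ℤ ℤ.+ (1ℤ ℤ.+ x)) ℤ.+ x ≡ ℤ.- + 2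
  lemma₂ = solve-∀

μ[s]⊗μ⁻¹[2+s] : ∀ s → μ s ⊗ μ⁻¹ (suc (suc s)) ≋ q⁻¹
μ[s]⊗μ⁻¹[2+s] s = yz-⊗-≡ (+ suc s) (ℤ.- + s) (ℤ.- + suc (suc (suc s))) (+ suc (suc s)) (lemma₁ (+ s)) (lemma₂ (+ s))
  where
  lemma₁ : ∀ x → (1ℤ ℤ.+ x) ℤ.+ ℤ.- (1ℤ ℤ.+ (1ℤ ℤ.+ (1ℤ ℤ.+ x))) ≡ ℤ.- + 2
  lemma₁ = solve-∀
  lemma₂ : ∀ x → ℤ.- x ℤ.+ (1ℤ ℤ.+ (1ℤ ℤ.+ x)) ≡ + 2
  lemma₂ = solve-∀

q⁻¹⊗q : q⁻¹ ⊗ q ≋ one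
q⁻¹⊗q = yz-⊗ (ℤ.- + 2) (+ 2) (+ 2) (ℤ.- + 2)

q⊗Q : ∀ t → q ⊗ Q t ≋ Q (suc t)
q⊗Q t = yz-⊗-≡ (+ 2) (ℤ.- + 2) (+ t ℤ.+ + t) (ℤ.- (+ t ℤ.+ + t)) (lemma₁ (+ t)) (lemma₂ (+ t))
  where
  lemma₁ : ∀ x → + 2 ℤ.+ (x ℤ.+ x) ≡ (1ℤ ℤ.+ x) ℤ.+ (1ℤ ℤ.+ x)
  lemma₁ = solve-∀
  lemma₂ : ∀ x → ℤ.- + 2 ℤ.+ ℤ.- (x ℤ.+ x) ≡ ℤ.- ((1ℤ ℤ.+ x) ℤ.+ (1ℤ ℤ.+ x))
  lemma₂ = solve-∀

C-∷ʳ : ∀ s → C (suc s) ≡ C s ++ (+ suc s , qexp (suc s)) ∷ []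
C-∷ʳ s = begin
  map f (map suc (upTo (suc s)))         ≡⟨ cong (λ ts → map f (map suc ts)) (List.upTo-∷ʳ s) ⟨
  map f (map suc (upTo s ++ s ∷ []))     ≡⟨ cong (map f) (List.map-++ suc (upTo s) (s ∷ [])) ⟩
  map f (map suc (upTo s) ++ suc s ∷ []) ≡⟨ List.map-++ f (map suc (upTo s)) (suc s ∷ []) ⟩
  C s ++ f (suc s) ∷ []                  ∎
  where
  open ≡-Reasoning
  f : ℕ → ℤ × Exp
  f t = (+ t , qexp t)

C-suc : ∀ s → C (suc s) ≋ C s ⊕ τ (suc s)
C-suc s = ≋-trans (≋-reflexive (C-∷ʳ s)) (⊕-cong (≋-refl {C s}) (term≋const⊗term (+ suc s) (qexp (suc s))))

τ-suc : ∀ t → τ (suc t) ≋ q ⊗ (Q t ⊕ τ t)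
τ-suc t = begin
  const (1ℤ ℤ.+ + t) ⊗ Q (suc t)          ≈⟨ ⊗-cong (const-+ 1ℤ (+ t)) (≋-sym (q⊗Q t)) ⟩
  (one ⊕ const (+ t)) ⊗ (q ⊗ Q t)        ≈⟨ lemma (const (+ t)) q (Q t) ⟩
  q ⊗ (Q t ⊕ τ t)                         ∎
  where
  open ≋-Reasoning
  lemma : ∀ c q Q → (one ⊕ c) ⊗ (q ⊗ Q) ≋ q ⊗ (Q ⊕ c ⊗ Q)
  lemma = solve 3 (λ c q Q → (con 1 :+ c) :* (q :* Q) := q :* (Q :+ c :* Q)) ≋-refl

q⁻¹⊗τ-suc : ∀ t → q⁻¹ ⊗ τ (suc t) ≋ Q t ⊕ τ t
q⁻¹⊗τ-suc t = begin
  q⁻¹ ⊗ τ (suc t)                ≈⟨ ⊗-cong (≋-refl {q⁻¹}) (τ-suc t) ⟩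
  q⁻¹ ⊗ (q ⊗ (Q t ⊕ τ t))        ≈⟨ ⊗-assoc q⁻¹ q (Q t ⊕ τ t) ⟨
  (q⁻¹ ⊗ q) ⊗ (Q t ⊕ τ t)        ≈⟨ ⊗-cong q⁻¹⊗q (≋-refl {Q t ⊕ τ t}) ⟩
  one ⊗ (Q t ⊕ τ t)              ≈⟨ ⊗-identityˡ (Q t ⊕ τ t) ⟩
  Q t ⊕ τ t                      ∎
  where open ≋-Reasoning

C-recurrence : ∀ s → q ⊗ C s ⊕ q⁻¹ ⊗ C (suc (suc s)) ≋ one ⊕ (C (suc s) ⊕ C (suc s))
C-recurrence zero = begin
  q ⊗ [] ⊕ q⁻¹ ⊗ C 2                          ≈⟨ ⊕-cong (≋-refl {q ⊗ []}) (⊗-cong (≋-refl {q⁻¹}) (≋-trans (C-suc 1) (⊕-cong (C-suc 0) ≋-refl))) ⟩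
  q ⊗ [] ⊕ q⁻¹ ⊗ (([] ⊕ τ 1) ⊕ τ 2)            ≈⟨ lemma q q⁻¹ (τ 1) (τ 2) ⟩
  q⁻¹ ⊗ τ 1 ⊕ q⁻¹ ⊗ τ 2                        ≈⟨ ⊕-cong (q⁻¹⊗τ-suc 0) (q⁻¹⊗τ-suc 1) ⟩
  (one ⊕ τ 0) ⊕ (Q 1 ⊕ τ 1)                    ≈⟨ ⊕-cong (⊕-cong (≋-refl {one}) τ0≋[]) (⊕-cong (≋-sym (⊗-identityˡ (Q 1))) ≋-refl) ⟩
  (one ⊕ []) ⊕ (τ 1 ⊕ τ 1)                     ≈⟨ ⊕-cong (⊕-identityʳ one) (⊕-cong (C-suc 0) (C-suc 0)) ⟨
  one ⊕ (C 1 ⊕ C 1)                            ∎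
  where
  open ≋-Reasoning
  τ0≋[] : τ 0 ≋ []
  τ0≋[] = ⟨ coeff-⊗ (const 0ℤ) (Q 0) ⟩
  lemma : ∀ q q⁻¹ a b → q ⊗ [] ⊕ q⁻¹ ⊗ (([] ⊕ a) ⊕ b) ≋ q⁻¹ ⊗ a ⊕ q⁻¹ ⊗ b
  lemma = solve 4 (λ q q⁻¹ a b → q :* con 0 :+ q⁻¹ :* ((con 0 :+ a) :+ b) := q⁻¹ :* a :+ q⁻¹ :* b) ≋-refl
C-recurrence (suc s) = begin
  q ⊗ C (suc s) ⊕ q⁻¹ ⊗ C (suc (suc (suc s)))
    ≈⟨ ⊕-cong (⊗-cong (≋-refl {q}) (C-suc s)) (⊗-cong (≋-refl {q⁻¹}) (C-suc (suc (suc s)))) ⟩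
  q ⊗ (C s ⊕ τ₁) ⊕ q⁻¹ ⊗ (C₂ ⊕ τ (suc (suc (suc s))))
    ≈⟨ regroup q q⁻¹ (C s) C₂ τ₁ (τ (suc (suc (suc s)))) ⟩
  (q ⊗ C s ⊕ q⁻¹ ⊗ C₂) ⊕ (q ⊗ τ₁ ⊕ q⁻¹ ⊗ τ (suc (suc (suc s))))
    ≈⟨ ⊕-cong (C-recurrence s) (⊕-cong (≋-refl {q ⊗ τ₁}) (≋-trans (q⁻¹⊗τ-suc (suc (suc s))) (⊕-cong (≋-sym (q⊗Q (suc s))) ≋-refl))) ⟩
  (one ⊕ (C₁ ⊕ C₁)) ⊕ (q ⊗ τ₁ ⊕ (q ⊗ Q (suc s) ⊕ τ₂))
    ≈⟨ regroup′ q C₁ τ₁ (Q (suc s)) τ₂ ⟩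
  one ⊕ ((C₁ ⊕ q ⊗ (Q (suc s) ⊕ τ₁)) ⊕ (C₁ ⊕ τ₂))
    ≈⟨ ⊕-cong (≋-refl {one}) (⊕-cong (⊕-cong (≋-refl {C₁}) (≋-sym (τ-suc (suc s)))) ≋-refl) ⟩
  one ⊕ ((C₁ ⊕ τ₂) ⊕ (C₁ ⊕ τ₂))
    ≈⟨ ⊕-cong (≋-refl {one}) (⊕-cong (C-suc (suc s)) (C-suc (suc s))) ⟨
  one ⊕ (C₂ ⊕ C₂) ∎
  where
  open ≋-Reasoning
  C₁ = C (suc s)
  C₂ = C (suc (suc s))
  τ₁ = τ (suc s)
  τ₂ = τ (suc (suc s))
  regroup : ∀ q q⁻¹ c c′ t t′ → q ⊗ (c ⊕ t) ⊕ q⁻¹ ⊗ (c′ ⊕ t′) ≋ (q ⊗ c ⊕ q⁻¹ ⊗ c′) ⊕ (q ⊗ t ⊕ q⁻¹ ⊗ t′)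
  regroup = solve 6 (λ q q⁻¹ c c′ t t′ → q :* (c :+ t) :+ q⁻¹ :* (c′ :+ t′) := (q :* c :+ q⁻¹ :* c′) :+ (q :* t :+ q⁻¹ :* t′)) ≋-refl
  regroup′ : ∀ q c t Q t′ → (one ⊕ (c ⊕ c)) ⊕ (q ⊗ t ⊕ (q ⊗ Q ⊕ t′)) ≋ one ⊕ ((c ⊕ q ⊗ (Q ⊕ t)) ⊕ (c ⊕ t′))
  regroup′ = solve 5 (λ q c t Q t′ → (con 1 :+ (c :+ c)) :+ (q :* t :+ (q :* Q :+ t′)) := con 1 :+ ((c :+ q :* (Q :+ t)) :+ (c :+ t′))) ≋-refl

XOrd≥-C : ∀ s → XOrd≥ 0ℤ (C s)
XOrd≥-C s = XOrd≥-terms 0ℤ (C s) (map⁺ (All.universal (λ _ → ℤ.≤-refl) (range 1 s)))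

XOrd≥-w : ∀ s → XOrd≥ 0ℤ (w s)
XOrd≥-w s = XOrd≥-⊗ (XOrd≥-mono 0ℤ (ℤ.- + suc s) (+ s)) (XOrd≥-C s)

T≈μ : ∀ s → T s ≈[x< + 2 ] μ s
T≈μ s = ⊕-XOrd≥ (XOrd≥-⊗ XOrd≥-X² (XOrd≥-w s))

XOrd≥-T : ∀ s → XOrd≥ 0ℤ (T s)
XOrd≥-T s = ≈[x<]-XOrd≥ (T≈μ s) (ℤ.+≤+ ℕ.z≤n) (XOrd≥-mono 0ℤ (+ suc s) (ℤ.- + s))

μ⊗w : ∀ s → μ s ⊗ w s ≋ C s
μ⊗w s = ≋-trans (⊗-assoc-≋ (μ s) (μ⁻¹ s) (C s) (μ⊗μ⁻¹ s)) (⊗-identityˡ (C s))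

T⊗T : ∀ s s′ → T s ⊗ T s′ ≈[x< + 4 ] μ s ⊗ μ s′ ⊕ X² ⊗ (μ s ⊗ w s′ ⊕ w s ⊗ μ s′)
T⊗T s s′ = expand-mod-x⁴ (μ s) (μ s′) (XOrd≥-w s) (XOrd≥-w s′)

T-recurrence : ∀ s → T (suc (suc s)) ⊗ T s ≈[x< + 4 ] X² ⊕ T (suc s) ⊗ T (suc s)
T-recurrence s = begin
  T (suc (suc s)) ⊗ T s                                       ≈⟨ T⊗T (suc (suc s)) s ⟩
  μ (suc (suc s)) ⊗ μ s ⊕ X² ⊗ (μ (suc (suc s)) ⊗ w s ⊕ w (suc (suc s)) ⊗ μ s)
    ≈⟨ ≋⇒≈[x<] (⊕-cong (μ[2+s]⊗μ[s] s) (⊗-cong (≋-refl {X²}) (≋-trans (⊕-cong middle₁ middle₂) (C-recurrence s)))) ⟩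
  μ₁ ⊗ μ₁ ⊕ X² ⊗ (one ⊕ (C (suc s) ⊕ C (suc s)))
    ≈⟨ ≋⇒≈[x<] (≋-trans (lemma (μ₁ ⊗ μ₁) X² (C (suc s))) (⊕-cong (≋-refl {X²}) (⊕-cong (≋-refl {μ₁ ⊗ μ₁}) (⊗-cong (≋-refl {X²}) (≋-sym (⊕-cong μ₁⊗w₁ (≋-trans (⊗-comm (w (suc s)) μ₁) μ₁⊗w₁))))))) ⟩
  X² ⊕ (μ₁ ⊗ μ₁ ⊕ X² ⊗ (μ₁ ⊗ w (suc s) ⊕ w (suc s) ⊗ μ₁))   ≈⟨ ⊕-cong-≈[x<] (≈[x<]-refl {p = X²}) (T⊗T (suc s) (suc s)) ⟨
  X² ⊕ T (suc s) ⊗ T (suc s)                                  ∎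
  where
  open ≈[x<]-Reasoning (+ 4)
  μ₁ = μ (suc s)
  μ₁⊗w₁ = μ⊗w (suc s)
  middle₁ : μ (suc (suc s)) ⊗ w s ≋ q ⊗ C s
  middle₁ = ⊗-assoc-≋ (μ (suc (suc s))) (μ⁻¹ s) (C s) (μ[2+s]⊗μ⁻¹[s] s)
  middle₂ : w (suc (suc s)) ⊗ μ s ≋ q⁻¹ ⊗ C (suc (suc s))
  middle₂ = ≋-trans (⊗-comm (w (suc (suc s))) (μ s)) (⊗-assoc-≋ (μ s) (μ⁻¹ (suc (suc s))) (C (suc (suc s))) (μ[s]⊗μ⁻¹[2+s] s))
  lemma : ∀ m x c → m ⊕ x ⊗ (one ⊕ (c ⊕ c)) ≋ x ⊕ (m ⊕ x ⊗ (c ⊕ c))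
  lemma = solve 3 (λ m x c → m :+ x :* (con 1 :+ (c :+ c)) := x :+ (m :+ x :* (c :+ c))) ≋-refl

module _ {M : ℕ → ℕ → Laurent} (isMarkov : IsMarkovFamily M) where
  open IsMarkovFamily isMarkov

  M-1/s-recurrence : ∀ s → M 1 (suc (suc s)) ⊗ M 1 s ≋ X² ⊕ M 1 (suc s) ⊗ M 1 (suc s)
  M-1/s-recurrence s = ≋-trans left-0/1 (⊕-cong (⊗-cong M₀₁≋X M₀₁≋X) ≋-refl)
    where
    left-0/1 : M 1 (suc (suc s)) ⊗ M 1 s ≋ M 0 1 ⊗ M 0 1 ⊕ M 1 (suc s) ⊗ M 1 (suc s)
    left-0/1 = ⟨ left 0 1 1 s refl ⟩
    M₀₁≋X : M 0 1 ≋ X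
    M₀₁≋X = ⟨ base₀₁ ⟩

  private
    M≈T-step : ∀ s → M 1 s ≈[x< + 3 ] T s → M 1 (suc s) ≈[x< + 3 ] T (suc s) →
               M 1 (suc (suc s)) ≈[x< + 3 ] T (suc (suc s))
    M≈T-step s M₀≈T₀ M₁≈T₁ = ≈[x<]-cancelʳ M₀≈μ (begin
      M 1 (suc (suc s)) ⊗ M 1 s                ≈⟨ ≋⇒≈[x<] (M-1/s-recurrence s) ⟩
      X² ⊕ M 1 (suc s) ⊗ M 1 (suc s)           ≈⟨ ⊕-cong-≈[x<] (≈[x<]-refl {p = X²}) (⊗-cong-≈[x<]₀ M₁≥0 (XOrd≥-T (suc s)) M₁≈T₁ M₁≈T₁) ⟩
      X² ⊕ T (suc s) ⊗ T (suc s)               ≈⟨ ≈[x<]-weaken (ℤ.+≤+ (ℕ.s≤s (ℕ.s≤s (ℕ.s≤s ℕ.z≤n)))) (T-recurrence s) ⟨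
      T (suc (suc s)) ⊗ T s                    ≈⟨ ⊗-congˡ-≈[x<]₀ (XOrd≥-T (suc (suc s))) M₀≈T₀ ⟨
      T (suc (suc s)) ⊗ M 1 s                  ∎)
      where
      open ≈[x<]-Reasoning (+ 3)
      M₁≥0 : XOrd≥ 0ℤ (M 1 (suc s))
      M₁≥0 = ≈[x<]-XOrd≥ M₁≈T₁ (ℤ.+≤+ ℕ.z≤n) (XOrd≥-T (suc s))
      M₀≈μ : M 1 s ≈[x< 1ℤ ] μ s
      M₀≈μ = ≈[x<]-trans (≈[x<]-weaken (ℤ.+≤+ (ℕ.s≤s ℕ.z≤n)) M₀≈T₀) (≈[x<]-weaken (ℤ.+≤+ (ℕ.s≤s ℕ.z≤n)) (T≈μ s))

    M≈T-pair : ∀ s → M 1 s ≈[x< + 3 ] T s × M 1 (suc s) ≈[x< + 3 ] T (suc s)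
    -- base₁₁ only pins down M_{1/1} ⊗ Z, so Z is cancelled.
    M≈T-pair zero    = ≋⇒≈[x<] M₁₀≋T₀ , ≈[x<]-cancelʳ {A = Z} ≈[x<]-refl (≋⇒≈[x<] (≋-trans M₁₁⊗Z≋ (⊕-comm X² (Y ⊗ Y))))
      where
      M₁₀≋T₀ : M 1 0 ≋ T 0
      M₁₀≋T₀ = ⟨ base₁₀ ⟩
      M₁₁⊗Z≋ : M 1 1 ⊗ Z ≋ X² ⊕ Y ⊗ Y
      M₁₁⊗Z≋ = ⟨ base₁₁ ⟩
    M≈T-pair (suc s) = let (M₀≈T₀ , M₁≈T₁) = M≈T-pair s in M₁≈T₁ , M≈T-step s M₀≈T₀ M₁≈T₁

  M≈T : ∀ s → M 1 s ≈[x< + 3 ] T s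
  M≈T s = proj₁ (M≈T-pair s)

  M²≈T² : ∀ s → M 1 s ⊗ M 1 s ≈[x< + 3 ] T s ⊗ T s
  M²≈T² s = ⊗-cong-≈[x<]₀ (≈[x<]-XOrd≥ (M≈T s) (ℤ.+≤+ ℕ.z≤n) (XOrd≥-T s)) (XOrd≥-T s) (M≈T s) (M≈T s)

coeff-term≡coeff₂-term : ∀ d c {c′} E {e} a b {j k} → d ℤ.* c ≡ c′ → (E ≡ e ⇔ (a ≡ j × b ≡ k)) →
                d ℤ.* coeff ((c , E) ∷ []) e ≡ coeff₂ ((c′ , a , b) ∷ []) j k
coeff-term≡coeff₂-term d c {c′} E {e} a b {j} {k} dc≡c′ match = begin
  d ℤ.* ((if E =ᵉ e then c else 0ℤ) ℤ.+ 0ℤ)                     ≡⟨ cong (λ β → d ℤ.* ((if β then c else 0ℤ) ℤ.+ 0ℤ)) same-test ⟩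
  d ℤ.* ((if ⌊ a ℕ.≟ j ⌋ ∧ ⌊ b ℕ.≟ k ⌋ then c else 0ℤ) ℤ.+ 0ℤ)   ≡⟨ lemma (⌊ a ℕ.≟ j ⌋ ∧ ⌊ b ℕ.≟ k ⌋) ⟩
  (if ⌊ a ℕ.≟ j ⌋ ∧ ⌊ b ℕ.≟ k ⌋ then c′ else 0ℤ) ℤ.+ 0ℤ          ∎
  where
  open ≡-Reasoning
  same-test : (E =ᵉ e) ≡ (⌊ a ℕ.≟ j ⌋ ∧ ⌊ b ℕ.≟ k ⌋)
  same-test = begin
    E =ᵉ e                                ≡⟨ =ᵉ≡does E e ⟩
    does (E ≟ᵉ e)                         ≡⟨ does-⇔ match (E ≟ᵉ e) (a ℕ.≟ j ×-dec b ℕ.≟ k) ⟩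
    does (a ℕ.≟ j) ∧ does (b ℕ.≟ k)       ≡⟨ cong₂ _∧_ (isYes≗does (a ℕ.≟ j)) (isYes≗does (b ℕ.≟ k)) ⟨
    ⌊ a ℕ.≟ j ⌋ ∧ ⌊ b ℕ.≟ k ⌋             ∎
  lemma : ∀ β → d ℤ.* ((if β then c else 0ℤ) ℤ.+ 0ℤ) ≡ (if β then c′ else 0ℤ) ℤ.+ 0ℤ
  lemma true  = trans (cong (d ℤ.*_) (ℤ.+-identityʳ c)) (trans dc≡c′ (sym (ℤ.+-identityʳ c′)))
  lemma false = ℤ.*-zeroʳ d

coeff₂-∷ : ∀ x xs j k → coeff₂ (x ∷ xs) j k ≡ coeff₂ (x ∷ []) j k ℤ.+ coeff₂ xs j k
coeff₂-∷ (c , a , b) xs j k =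
  cong (ℤ._+ coeff₂ xs j k) (sym (ℤ.+-identityʳ (if ⌊ a ℕ.≟ j ⌋ ∧ ⌊ b ℕ.≟ k ⌋ then c else 0ℤ)))

coeff-map≡coeff₂-map : ∀ d (f : ℕ → ℤ × Exp) (g : ℕ → ℤ × ℕ × ℕ) {e j k} xs →
               All (λ t → d ℤ.* coeff (f t ∷ []) e ≡ coeff₂ (g t ∷ []) j k) xs →
               d ℤ.* coeff (map f xs) e ≡ coeff₂ (map g xs) j k
coeff-map≡coeff₂-map d f g         []       []         = ℤ.*-zeroʳ d
coeff-map≡coeff₂-map d f g {e} {j} {k} (t ∷ xs) (ft≡gt ∷ fxs≡gxs) = begin
  d ℤ.* coeff (f t ∷ map f xs) e                             ≡⟨ cong (d ℤ.*_) (coeff-++ (f t ∷ []) (map f xs) e) ⟩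
  d ℤ.* (coeff (f t ∷ []) e ℤ.+ coeff (map f xs) e)          ≡⟨ ℤ.*-distribˡ-+ d _ _ ⟩
  d ℤ.* coeff (f t ∷ []) e ℤ.+ d ℤ.* coeff (map f xs) e      ≡⟨ cong₂ ℤ._+_ ft≡gt (coeff-map≡coeff₂-map d f g xs fxs≡gxs) ⟩
  coeff₂ (g t ∷ []) j k ℤ.+ coeff₂ (map g xs) j k            ≡⟨ coeff₂-∷ (g t) (map g xs) j k ⟨
  coeff₂ (g t ∷ map g xs) j k                                ∎
  where open ≡-Reasoning

m+m≡n+n⇒m≡n : ∀ m n → m ℕ.+ m ≡ n ℕ.+ n → m ≡ n
m+m≡n+n⇒m≡n m n eq = ℕ.*-cancelˡ-≡ m n 2 (begin
  m ℕ.+ (m ℕ.+ 0)   ≡⟨ cong (m ℕ.+_) (ℕ.+-identityʳ m) ⟩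
  m ℕ.+ m           ≡⟨ eq ⟩
  n ℕ.+ n           ≡⟨ cong (n ℕ.+_) (ℕ.+-identityʳ n) ⟨
  n ℕ.+ (n ℕ.+ 0)   ∎)
  where open ≡-Reasoning

t+t≡[a+a]-[b+b]⇔b+t≡a : ∀ t a b → (+ t ℤ.+ + t ≡ (+ a ℤ.+ + a) ℤ.- (+ b ℤ.+ + b)) ⇔ (b ℕ.+ t ≡ a)
t+t≡[a+a]-[b+b]⇔b+t≡a t a b = mk⇔ to from
  where
  to : + t ℤ.+ + t ≡ (+ a ℤ.+ + a) ℤ.- (+ b ℤ.+ + b) → b ℕ.+ t ≡ a
  to eq = m+m≡n+n⇒m≡n (b ℕ.+ t) a (trans (reorder b t) (ℤ.+-injective (trans (cong (λ x → (+ b ℤ.+ + b) ℤ.+ x) eq) (cancel (+ a ℤ.+ + a) (+ b ℤ.+ + b)))))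
    where
    reorder : ∀ b t → (b ℕ.+ t) ℕ.+ (b ℕ.+ t) ≡ (b ℕ.+ b) ℕ.+ (t ℕ.+ t)
    reorder = ℕ-solve-∀
    cancel : ∀ u v → v ℤ.+ (u ℤ.- v) ≡ u
    cancel = solve-∀
  from : b ℕ.+ t ≡ a → + t ℤ.+ + t ≡ (+ a ℤ.+ + a) ℤ.- (+ b ℤ.+ + b)
  from refl = lemma (+ b) (+ t)
    where
    lemma : ∀ b t → t ℤ.+ t ≡ ((b ℤ.+ t) ℤ.+ (b ℤ.+ t)) ℤ.- (b ℤ.+ b)
    lemma = solve-∀

-x≡u-v⇔x≡v-u : ∀ x u v → (ℤ.- x ≡ u ℤ.- v) ⇔ (x ≡ v ℤ.- u)
-x≡u-v⇔x≡v-u x u v = mk⇔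
  (λ eq → trans (sym (ℤ.neg-involutive x)) (trans (cong ℤ.-_ eq) (lemma u v)))
  (λ eq → trans (cong ℤ.-_ eq) (lemma v u))
  where
  lemma : ∀ u v → ℤ.- (u ℤ.- v) ≡ v ℤ.- u
  lemma = solve-∀

even-exp : ℕ → ℕ → ℕ → ℕ → Exp
even-exp a b c d = (0ℤ , (+ a ℤ.+ + a) ℤ.- (+ b ℤ.+ + b) , (+ c ℤ.+ + c) ℤ.- (+ d ℤ.+ + d))

qexp-≡⇔ : ∀ t a b c d → (qexp t ≡ even-exp a b c d) ⇔ (b ℕ.+ t ≡ a × c ℕ.+ t ≡ d)
qexp-≡⇔ t a b c d = mk⇔
  (λ eq → Equivalence.to y-part (cong (proj₁ ∘ proj₂) eq) , Equivalence.to z-part (cong (proj₂ ∘ proj₂) eq))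
  (λ (y≡ , z≡) → cong₂ (λ y z → (0ℤ , y , z)) (Equivalence.from y-part y≡) (Equivalence.from z-part z≡))
  where
  y-part = t+t≡[a+a]-[b+b]⇔b+t≡a t a b
  z-part = ⇔-trans (-x≡u-v⇔x≡v-u (+ t ℤ.+ + t) (+ c ℤ.+ + c) (+ d ℤ.+ + d)) (t+t≡[a+a]-[b+b]⇔b+t≡a t d c)

x²ᵉ : Exp
x²ᵉ = (+ 2 , 0ℤ , 0ℤ)

coeff-yz⊕X²⊗ : ∀ b c p e → xdeg e ≡ + 2 → coeff (yz b c ⊕ X² ⊗ p) e ≡ coeff p (e -ᵉ x²ᵉ)
coeff-yz⊕X²⊗ b c p e e₁≡2 = begin
  coeff (yz b c ⊕ X² ⊗ p) e                    ≡⟨ coeff-++ (yz b c) (X² ⊗ p) e ⟩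
  coeff (yz b c) e ℤ.+ coeff (X² ⊗ p) e        ≡⟨ cong₂ ℤ._+_ yz-vanishes (coeff-≡ (⊗-cong (mono-⊗ 1ℤ 0ℤ 0ℤ 1ℤ 0ℤ 0ℤ) (≋-refl {p})) e) ⟩
  0ℤ ℤ.+ coeff (mono (+ 2) 0ℤ 0ℤ ⊗ p) e        ≡⟨ ℤ.+-identityˡ _ ⟩
  coeff (mono (+ 2) 0ℤ 0ℤ ⊗ p) e               ≡⟨ coeff-mono-⊗ (+ 2) 0ℤ 0ℤ p e ⟩
  coeff p (e -ᵉ x²ᵉ)                           ∎
  where
  open ≡-Reasoning
  yz-vanishes : coeff (yz b c) e ≡ 0ℤ
  yz-vanishes rewrite =ᵉ-≢ {(0ℤ , b , c)} {e} (λ eq → case trans (cong xdeg eq) e₁≡2 of λ ()) = refl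

coeff-T-x² : ∀ s e → xdeg e ≡ + 2 → coeff (T s) e ≡ coeff (C s) (e -ᵉ x²ᵉ -ᵉ (0ℤ , ℤ.- + suc s , + s))
coeff-T-x² s e e₁≡2 = trans (coeff-yz⊕X²⊗ (+ suc s) (ℤ.- + s) (w s) e e₁≡2) (coeff-mono-⊗ 0ℤ (ℤ.- + suc s) (+ s) (C s) (e -ᵉ x²ᵉ))

coeff-T²-x² : ∀ s e → xdeg e ≡ + 2 → coeff (T s ⊗ T s) e ≡ coeff (C s ⊕ C s) (e -ᵉ x²ᵉ)
coeff-T²-x² s e e₁≡2 = begin
  coeff (T s ⊗ T s) e                                              ≡⟨ agree (T⊗T s s) e (subst (ℤ._< + 4) (sym e₁≡2) (ℤ.+<+ (ℕ.s≤s (ℕ.s≤s (ℕ.s≤s ℕ.z≤n))))) ⟩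
  coeff (μ s ⊗ μ s ⊕ X² ⊗ (μ s ⊗ w s ⊕ w s ⊗ μ s)) e               ≡⟨ coeff-≡ (⊕-cong (yz-⊗ (+ suc s) (ℤ.- + s) (+ suc s) (ℤ.- + s)) (⊗-cong (≋-refl {X²}) (⊕-cong (μ⊗w s) (≋-trans (⊗-comm (w s) (μ s)) (μ⊗w s))))) e ⟩
  coeff (yz (+ suc s ℤ.+ + suc s) (ℤ.- + s ℤ.+ ℤ.- + s) ⊕ X² ⊗ (C s ⊕ C s)) e ≡⟨ coeff-yz⊕X²⊗ (+ suc s ℤ.+ + suc s) (ℤ.- + s ℤ.+ ℤ.- + s) (C s ⊕ C s) e e₁≡2 ⟩
  coeff (C s ⊕ C s) (e -ᵉ x²ᵉ)                                     ∎
  where open ≡-Reasoning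

+[2*n]≡n+n : ∀ n → + (2 * n) ≡ + n ℤ.+ + n
+[2*n]≡n+n n = cong (λ x → + (n ℕ.+ x)) (ℕ.+-identityʳ n)

m+n≡o⇔o∸n≡m : ∀ m {n o} → n ℕ.≤ o → (m ℕ.+ n ≡ o) ⇔ (o ∸ n ≡ m)
m+n≡o⇔o∸n≡m m {n} n≤o = mk⇔ (λ { refl → ℕ.m+n∸n≡m m n }) (λ { refl → ℕ.m∸n+n≡m n≤o })

suc-injective⇔ : ∀ {m n} → (suc m ≡ suc n) ⇔ (m ≡ n)
suc-injective⇔ = mk⇔ ℕ.suc-injective (cong suc)

C-coeff≡target₁ : ∀ n j k → coeff (C n) (even-exp (suc j) 0 k n) ≡ coeff₂ (target₁ n) j k
C-coeff≡target₁ n j k = trans (sym (ℤ.*-identityˡ _)) (coeff-map≡coeff₂-map 1ℤ _ _ (range 1 n) (map⁺ (applyUpTo⁺₁ id n per-term)))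
  where
  per-term : ∀ {i} → i ℕ.< n → 1ℤ ℤ.* coeff ((+ suc i , qexp (suc i)) ∷ []) (even-exp (suc j) 0 k n)
                               ≡ coeff₂ ((+ suc i , suc i ∸ 1 , n ∸ suc i) ∷ []) j k
  per-term {i} i<n = coeff-term≡coeff₂-term 1ℤ (+ suc i) (qexp (suc i)) (suc i ∸ 1) (n ∸ suc i) (ℤ.*-identityˡ (+ suc i))
    (⇔-trans (qexp-≡⇔ (suc i) (suc j) 0 k n) (suc-injective⇔ ×-⇔ m+n≡o⇔o∸n≡m k i<n))

2C⊕2C-coeff≡target₂ : ∀ m j k → let F = even-exp j m k (suc m) in
  coeff (C (suc m) ⊕ C (suc m)) F ℤ.+ coeff (C m ⊕ C m) F ≡ coeff₂ (target₂ (suc m)) j k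
2C⊕2C-coeff≡target₂ m j k = begin
  coeff (C (suc m) ⊕ C (suc m)) F ℤ.+ coeff (C m ⊕ C m) F
    ≡⟨ cong₂ ℤ._+_ (coeff-++ (C (suc m)) (C (suc m)) F) (coeff-++ (C m) (C m) F) ⟩
  coeff (C (suc m)) F ℤ.+ coeff (C (suc m)) F ℤ.+ (coeff (C m) F ℤ.+ coeff (C m) F)
    ≡⟨ cong (λ x → x ℤ.+ x ℤ.+ (coeff (C m) F ℤ.+ coeff (C m) F)) (trans (cong (λ C′ → coeff C′ F) (C-∷ʳ m)) (coeff-++ (C m) (h ∷ []) F)) ⟩
  (coeff (C m) F ℤ.+ coeff (h ∷ []) F) ℤ.+ (coeff (C m) F ℤ.+ coeff (h ∷ []) F) ℤ.+ (coeff (C m) F ℤ.+ coeff (C m) F)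
    ≡⟨ regroup (coeff (C m) F) (coeff (h ∷ []) F) ⟩
  + 2 ℤ.* coeff (h ∷ []) F ℤ.+ + 4 ℤ.* coeff (C m) F
    ≡⟨ cong₂ ℤ._+_ head-term (coeff-map≡coeff₂-map (+ 4) _ _ (range 1 m) (map⁺ (applyUpTo⁺₁ id m per-term))) ⟩
  coeff₂ (head ∷ []) j k ℤ.+ coeff₂ (map g (range 1 m)) j k
    ≡⟨ coeff₂-∷ head (map g (range 1 m)) j k ⟨
  coeff₂ (target₂ (suc m)) j k ∎
  where
  open ≡-Reasoning
  F = even-exp j m k (suc m)
  h = (+ suc m , qexp (suc m))
  head = (+ (2 * suc m) , 2 * suc m ∸ 1 , 0)
  g : ℕ → ℤ × ℕ × ℕ
  g t = (+ (4 * t) , suc m ℕ.+ t ∸ 1 , suc m ∸ t)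
  regroup : ∀ c t → (c ℤ.+ t) ℤ.+ (c ℤ.+ t) ℤ.+ (c ℤ.+ c) ≡ + 2 ℤ.* t ℤ.+ + 4 ℤ.* c
  regroup = solve-∀
  head-term : + 2 ℤ.* coeff (h ∷ []) F ≡ coeff₂ (head ∷ []) j k
  head-term = coeff-term≡coeff₂-term (+ 2) (+ suc m) (qexp (suc m)) (2 * suc m ∸ 1) 0 (sym (ℤ.pos-* 2 (suc m)))
    (⇔-trans (qexp-≡⇔ (suc m) j m k (suc m)) (y-part ×-⇔ z-part))
    where
    2[1+m]∸1≡m+[1+m] : 2 * suc m ∸ 1 ≡ m ℕ.+ suc m
    2[1+m]∸1≡m+[1+m] = cong (λ x → m ℕ.+ suc x) (ℕ.+-identityʳ m)
    y-part : (m ℕ.+ suc m ≡ j) ⇔ (2 * suc m ∸ 1 ≡ j)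
    y-part = mk⇔ (trans 2[1+m]∸1≡m+[1+m]) (trans (sym 2[1+m]∸1≡m+[1+m]))
    z-part : (k ℕ.+ suc m ≡ suc m) ⇔ (0 ≡ k)
    z-part = ⇔-trans (m+n≡o⇔o∸n≡m k ℕ.≤-refl) (mk⇔ (trans (sym (ℕ.n∸n≡0 m))) (trans (ℕ.n∸n≡0 m)))
  per-term : ∀ {i} → i ℕ.< m → + 4 ℤ.* coeff ((+ suc i , qexp (suc i)) ∷ []) F ≡ coeff₂ (g (suc i) ∷ []) j k
  per-term {i} i<m = coeff-term≡coeff₂-term (+ 4) (+ suc i) (qexp (suc i)) (suc m ℕ.+ suc i ∸ 1) (suc m ∸ suc i)
    (sym (ℤ.pos-* 4 (suc i))) (⇔-trans (qexp-≡⇔ (suc i) j m k (suc m)) (⇔-refl ×-⇔ m+n≡o⇔o∸n≡m k (ℕ.s≤s (ℕ.<⇒≤ i<m))))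

private
  2<3 : + 2 ℤ.< + 3
  2<3 = ℤ.+<+ (ℕ.s≤s (ℕ.s≤s (ℕ.s≤s ℕ.z≤n)))

module _ {M : ℕ → ℕ → Laurent} (isMarkov : IsMarkovFamily M) where

  S₁-1/n : ∀ n j k → S₁coeff M 1 n j k ≡ coeff (C n) (even-exp (suc j) 0 k n)
  S₁-1/n n j k = begin
    coeff (yz b₀ c₀ ⊗ M 1 n) E              ≡⟨ agree (⊗-congˡ-≈[x<]₀ (XOrd≥-mono 0ℤ b₀ c₀) (M≈T isMarkov n)) E 2<3 ⟩
    coeff (yz b₀ c₀ ⊗ T n) E                ≡⟨ coeff-mono-⊗ 0ℤ b₀ c₀ (T n) E ⟩
    coeff (T n) (E -ᵉ (0ℤ , b₀ , c₀))       ≡⟨ coeff-T-x² n (E -ᵉ (0ℤ , b₀ , c₀)) refl ⟩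
    coeff (C n) E′                          ≡⟨ cong (coeff (C n)) E′≡ ⟩
    coeff (C n) (even-exp (suc j) 0 k n)    ∎
    where
    open ≡-Reasoning
    b₀ = + n ℤ.- 1ℤ
    c₀ = + (1 ℕ.+ n) ℤ.- 1ℤ
    E  = (+ 2 , + (2 * j) , + (2 * k))
    E′ = E -ᵉ (0ℤ , b₀ , c₀) -ᵉ x²ᵉ -ᵉ (0ℤ , ℤ.- + suc n , + n)
    E′≡ : E′ ≡ even-exp (suc j) 0 k n
    E′≡ = componentwise refl
      (trans (cong (λ x → ((x ℤ.- b₀) ℤ.- 0ℤ) ℤ.- ℤ.- + suc n) (+[2*n]≡n+n j)) (y-lemma (+ j) (+ n)))
      (trans (cong (λ x → ((x ℤ.- c₀) ℤ.- 0ℤ) ℤ.- + n) (+[2*n]≡n+n k)) (z-lemma (+ k) (+ n)))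
      where
      y-lemma : ∀ j n → ((j ℤ.+ j ℤ.- (n ℤ.- 1ℤ)) ℤ.- 0ℤ) ℤ.- ℤ.- (1ℤ ℤ.+ n) ≡ ((1ℤ ℤ.+ j) ℤ.+ (1ℤ ℤ.+ j)) ℤ.- (0ℤ ℤ.+ 0ℤ)
      y-lemma = solve-∀
      z-lemma : ∀ k n → ((k ℤ.+ k ℤ.- ((1ℤ ℤ.+ n) ℤ.- 1ℤ)) ℤ.- 0ℤ) ℤ.- n ≡ (k ℤ.+ k) ℤ.- (n ℤ.+ n)
      z-lemma = solve-∀

  X⊗M-2/[2m+1] : ∀ m → X ⊗ M 2 (suc (2 * m)) ≋ M 1 (suc m) ⊗ M 1 (suc m) ⊕ M 1 m ⊗ M 1 m
  X⊗M-2/[2m+1] m = ≋-trans (⊗-comm X (M 2 (suc (2 * m)))) (≋-trans (⊗-cong (≋-refl {M 2 (suc (2 * m))}) (≋-sym M₀₁≋X)) right-0/1)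
    where
    open IsMarkovFamily isMarkov
    right-0/1 : M 2 (suc (2 * m)) ⊗ M 0 1 ≋ M 1 (suc m) ⊗ M 1 (suc m) ⊕ M 1 m ⊗ M 1 m
    right-0/1 = ⟨ right 0 1 1 m refl ⟩
    M₀₁≋X : M 0 1 ≋ X
    M₀₁≋X = ⟨ base₀₁ ⟩

  S₁-2/[2m+1] : ∀ m j k → let F = even-exp j m k (suc m) in
    S₁coeff M 2 (suc (2 * m)) j k ≡ coeff (C (suc m) ⊕ C (suc m)) F ℤ.+ coeff (C m ⊕ C m) F
  S₁-2/[2m+1] m j k = begin
    coeff (mono 1ℤ b₀ c₀ ⊗ M 2 N) E                               ≡⟨ coeff-mono-⊗ 1ℤ b₀ c₀ (M 2 N) E ⟩
    coeff (M 2 N) E₁                                              ≡⟨ cong (coeff (M 2 N)) (e+f-f≡e E₁ xᵉ) ⟨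
    coeff (M 2 N) (E₁ +ᵉ xᵉ -ᵉ xᵉ)                                ≡⟨ coeff-mono-⊗ 1ℤ 0ℤ 0ℤ (M 2 N) (E₁ +ᵉ xᵉ) ⟨
    coeff (X ⊗ M 2 N) (E₁ +ᵉ xᵉ)                                  ≡⟨ coeff-≡ (X⊗M-2/[2m+1] m) (E₁ +ᵉ xᵉ) ⟩
    coeff (M 1 (suc m) ⊗ M 1 (suc m) ⊕ M 1 m ⊗ M 1 m) (E₁ +ᵉ xᵉ)
      ≡⟨ agree (⊕-cong-≈[x<] (M²≈T² isMarkov (suc m)) (M²≈T² isMarkov m)) (E₁ +ᵉ xᵉ) 2<3 ⟩
    coeff (T (suc m) ⊗ T (suc m) ⊕ T m ⊗ T m) (E₁ +ᵉ xᵉ)          ≡⟨ coeff-++ (T (suc m) ⊗ T (suc m)) (T m ⊗ T m) (E₁ +ᵉ xᵉ) ⟩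
    coeff (T (suc m) ⊗ T (suc m)) (E₁ +ᵉ xᵉ) ℤ.+ coeff (T m ⊗ T m) (E₁ +ᵉ xᵉ)
      ≡⟨ cong₂ ℤ._+_ (coeff-T²-x² (suc m) (E₁ +ᵉ xᵉ) refl) (coeff-T²-x² m (E₁ +ᵉ xᵉ) refl) ⟩
    coeff (C (suc m) ⊕ C (suc m)) E′ ℤ.+ coeff (C m ⊕ C m) E′
      ≡⟨ cong (λ e → coeff (C (suc m) ⊕ C (suc m)) e ℤ.+ coeff (C m ⊕ C m) e) E′≡ ⟩
    coeff (C (suc m) ⊕ C (suc m)) F ℤ.+ coeff (C m ⊕ C m) F       ∎
    where
    open ≡-Reasoning
    N  = suc (2 * m)
    b₀ = + N ℤ.- 1ℤ
    c₀ = + (2 ℕ.+ N) ℤ.- 1ℤ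
    xᵉ = (1ℤ , 0ℤ , 0ℤ)
    E  = (+ 2 , + (2 * j) , + (2 * k))
    E₁ = E -ᵉ (1ℤ , b₀ , c₀)
    E′ = E₁ +ᵉ xᵉ -ᵉ x²ᵉ
    F  = even-exp j m k (suc m)
    E′≡ : E′ ≡ F
    E′≡ = componentwise refl
      (trans (cong₂ (λ x y → ((x ℤ.- ((1ℤ ℤ.+ y) ℤ.- 1ℤ)) ℤ.+ 0ℤ) ℤ.- 0ℤ) (+[2*n]≡n+n j) (+[2*n]≡n+n m)) (y-lemma (+ j) (+ m)))
      (trans (cong₂ (λ x y → ((x ℤ.- ((1ℤ ℤ.+ (1ℤ ℤ.+ (1ℤ ℤ.+ y))) ℤ.- 1ℤ)) ℤ.+ 0ℤ) ℤ.- 0ℤ) (+[2*n]≡n+n k) (+[2*n]≡n+n m)) (z-lemma (+ k) (+ m)))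
      where
      y-lemma : ∀ j m → ((j ℤ.+ j ℤ.- ((1ℤ ℤ.+ (m ℤ.+ m)) ℤ.- 1ℤ)) ℤ.+ 0ℤ) ℤ.- 0ℤ ≡ (j ℤ.+ j) ℤ.- (m ℤ.+ m)
      y-lemma = solve-∀
      z-lemma : ∀ k m → ((k ℤ.+ k ℤ.- ((1ℤ ℤ.+ (1ℤ ℤ.+ (1ℤ ℤ.+ (m ℤ.+ m)))) ℤ.- 1ℤ)) ℤ.+ 0ℤ) ℤ.- 0ℤ
                        ≡ (k ℤ.+ k) ℤ.- ((1ℤ ℤ.+ m) ℤ.+ (1ℤ ℤ.+ m))
      z-lemma = solve-∀

theorem4p3 : (M : ℕ → ℕ → Laurent) → IsMarkovFamily M →
    (n : ℕ) → 1 ≤ n →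
      (∀ j k → S₁coeff M 1 n j k ≡ coeff₂ (target₁ n) j k)
      × (∀ j k → S₁coeff M 2 (2 * n ∸ 1) j k ≡ coeff₂ (target₂ n) j k)
theorem4p3 M isMarkov (suc m) (ℕ.s≤s ℕ.z≤n) = S₁-1/[1+m] , S₁-2/[2[1+m]-1]
  where
  S₁-1/[1+m] : ∀ j k → S₁coeff M 1 (suc m) j k ≡ coeff₂ (target₁ (suc m)) j k
  S₁-1/[1+m] j k = trans (S₁-1/n isMarkov (suc m) j k) (C-coeff≡target₁ (suc m) j k)
  2[1+m]∸1≡1+2m : 2 * suc m ∸ 1 ≡ suc (2 * m)
  2[1+m]∸1≡1+2m = ℕ.+-suc m (m ℕ.+ 0)
  S₁-2/[2[1+m]-1] : ∀ j k → S₁coeff M 2 (2 * suc m ∸ 1) j k ≡ coeff₂ (target₂ (suc m)) j k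
  S₁-2/[2[1+m]-1] j k = subst (λ N → S₁coeff M 2 N j k ≡ coeff₂ (target₂ (suc m)) j k) (sym 2[1+m]∸1≡1+2m)
                               (trans (S₁-2/[2m+1] isMarkov m j k) (2C⊕2C-coeff≡target₂ m j k))
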